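{- For all $m\geq 3$, $n\geq 3$ and every jump $\ell\in\{0,1,\dots,n-1\}$, the pseudo-Cartesian product $C_m\Box_\ell C_n$ is $2$-spanning cyclable.
   Context: The pseudo-Cartesian product $C_m\Box_\ell C_n$ ($m,n\ge 3$) has vertices $u_{i,j}$, $0\le i\le m-1$, $j\in\mathbb{Z}_n$, and edges $[u_{i,j},u_{i,j+1}]$ for all $i,j$, $[u_{i,j},u_{i+1,j}]$ for $0\le i\le m-2$, and $[u_{m-1,j},u_{0,j+\ell}]$ for all $j$ (second indices mod $n$). For $\ell=0$ it is the Cartesian product $C_m\Box C_n$. A 2-factor of a graph is a spanning subgraph in which every vertex has valency 2; it separates a set $A$ of $k$ vertices if it consists of exactly $k$ cycles and $A$ meets the vertex set of each cycle in exactly one vertex. A graph $X$ is $k$-spanning cyclable if for every $A\subseteq V(X)$ with $|A|=k$ there is a 2-factor of $X$ separating $A$. -}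

module Defs where

open import Data.Nat using (ℕ; zero; suc; _+_; _<_)
open import Data.Nat.DivMod using (_%_; m%n<n)
open import Data.Fin using (Fin; toℕ; fromℕ<)
open import Data.Product using (_×_; _,_; Σ; ∃; ∃-syntax)
open import Data.Sum using (_⊎_)
open import Data.List using (List; length)
open import Data.List.Membership.Propositional using (_∈_)
open import Data.List.Relation.Unary.Unique.Propositional using (Unique)
open import Relation.Binary.PropositionalEquality using (_≡_; _≢_)
open import Relation.Binary.Construct.Closure.ReflexiveTransitive using (Star)

addMod : ∀ {n} → Fin n → ℕ → Fin n
addMod {suc k} j s = fromℕ< (m%n<n (toℕ j + s) (suc k))

Vertex : ℕ → ℕ → Set
Vertex m n = Fin m × Fin n

-- directed description of each (undirected) edge of C_m □_ℓ C_n
data Edge (m n ℓ : ℕ) : Vertex m n → Vertex m n → Set where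
  horiz : ∀ i j → Edge m n ℓ (i , j) (i , addMod j 1)
  vert  : ∀ i i' j → toℕ i' ≡ suc (toℕ i) → Edge m n ℓ (i , j) (i' , j)
  jump  : ∀ i i' j → suc (toℕ i) ≡ m → toℕ i' ≡ 0 →
          Edge m n ℓ (i , j) (i' , addMod j ℓ)

Adj : (m n ℓ : ℕ) → Vertex m n → Vertex m n → Set
Adj m n ℓ u v = Edge m n ℓ u v ⊎ Edge m n ℓ v u

IsTwoFactor : ∀ {V : Set} → (G : V → V → Set) → (F : V → V → Set) → Set
IsTwoFactor {V} G F =
  (∀ u v → F u v → F v u) ×
  (∀ u v → F u v → G u v) ×
  (∀ u → Σ V λ v → Σ V λ w →
     v ≢ w × F u v × F u w × (∀ x → F u x → x ≡ v ⊎ x ≡ w))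

-- The 2-factor F separates the set A (a duplicate-free list): the cycles of F
-- are its connected components; every component contains an element of A and
-- no component contains two distinct elements of A.  Hence F consists of
-- exactly |A| cycles, each meeting A in exactly one vertex.
Separates : ∀ {V : Set} → (F : V → V → Set) → List V → Set
Separates {V} F A =
  (∀ x → ∃[ a ] (a ∈ A × Star F a x)) ×
  (∀ a b → a ∈ A → b ∈ A → Star F a b → a ≡ b)

SpanningCyclable : ∀ {V : Set} → (G : V → V → Set) → ℕ → Set₁
SpanningCyclable {V} G k =
  ∀ (A : List V) → Unique A → length A ≡ k →
    ∃[ F ] (IsTwoFactor G F × Separates F A)

{-# OPTIONS --safe #-}
module Submission where

open import Defs
open import Level using (0ℓ)
open import Data.Empty using (⊥; ⊥-elim)
open import Data.Nat
  using (ℕ; zero; suc; pred; _+_; _∸_; _<_; _≤_; _<?_; _≤?_; _≟_; z≤n; s≤s; NonZero; >-nonZero; parity)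
open import Data.Nat.Properties hiding (_≟_)
open import Algebra.Properties.CommutativeSemigroup +-commutativeSemigroup using (xy∙z≈xz∙y)
open import Data.Nat.DivMod
  using (_%_; _mod_; m%n<n; m<n⇒m%n≡m; n%n≡0; m%n%n≡m%n; %-distribˡ-+; [m+n]%n≡m%n)
open import Data.Parity.Base using (Parity; 0ℙ; 1ℙ; _⁻¹)
open import Data.Parity.Properties using (suc-homo-⁻¹; ⁻¹-selfInverse)
open import Data.Fin using (Fin; toℕ) renaming (zero to fzero; suc to fsuc)
open import Data.Fin.Properties using (toℕ-injective; toℕ-fromℕ<; toℕ<n)
open import Data.Product using (_×_; _,_; proj₁; proj₂; ∃-syntax; map₁; map₂; swap)
open import Data.Product.Properties using (,-injectiveˡ; ,-injectiveʳ; ≡-dec)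
open import Data.Sum using (_⊎_; inj₁; inj₂; [_,_]′)
import Data.Sum as Sum
open import Data.List using ([]; _∷_)
open import Data.List.Membership.Propositional using (_∈_)
open import Data.List.Membership.Propositional.Properties using (∈-map⁺; ∈-map⁻)
open import Data.List.Relation.Unary.Any using (here; there)
open import Data.List.Relation.Unary.All using ([]; _∷_)
open import Data.List.Relation.Unary.AllPairs using ([]; _∷_)
open import Function using (_∘_; _↔_; mk↔ₛ′; Inverse)
open import Relation.Nullary using (¬_; Dec; yes; no; contradiction)
open import Relation.Nullary.Decidable using (_×-dec_)
open import Relation.Binary.Core using (Rel)
open import Relation.Binary.Definitions using (Symmetric; DecidableEquality; tri<; tri≈; tri>)
open import Relation.Binary.PropositionalEquality
open import Relation.Binary.Construct.Closure.ReflexiveTransitive using (Star; ε; _◅_; _◅◅_)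
import Relation.Binary.Construct.Closure.ReflexiveTransitive as Star

-- Two distinct vertices a and b are separated by a 2-factor with two cycles as soon as the
-- vertex set splits into two parts, containing a and b respectively, that both carry a Hamiltonian
-- cycle; the union of the two cycles is the 2-factor.
--
-- If a and b lie in different rows, cut between those rows.
--
-- If they lie in the same row, the column rotations and the row shift (i , j) ↦ (i + 1 , j), which
-- sends the last row to the first one rotated by ℓ, are automorphisms; so we may assume that a lies
-- in the square {0,1} × {1,2} and b outside it. The square is a 4-cycle, and its complement is
-- Hamiltonian: for n ≥ 4 it is a comb with the square bypassed by one chord, and for n = 3 and ℓ = 1
-- a cycle running along the columns through one jump edge. The case n = 3, ℓ = 2 is the mirror
-- image of ℓ = 1, and for ℓ = 0 exchanging rows and columns puts two cells of a common row into
-- distinct rows.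

SeparatingTwoFactor : {V : Set} → Rel V 0ℓ → V → V → Set₁
SeparatingTwoFactor G a b = ∃[ F ] (IsTwoFactor G F × Separates F (a ∷ b ∷ []))

module _ {V : Set} {G : Rel V 0ℓ} where

  private
    ∈-pair-swap : ∀ {x a b : V} → x ∈ a ∷ b ∷ [] → x ∈ b ∷ a ∷ []
    ∈-pair-swap (here x≡a) = there (here x≡a)
    ∈-pair-swap (there (here x≡b)) = here x≡b

  separatingTwoFactor-sym : ∀ {a b} → SeparatingTwoFactor G a b → SeparatingTwoFactor G b a
  separatingTwoFactor-sym (F , factor , covers , separates) =
    F , factor , map₂ (map₁ ∈-pair-swap) ∘ covers ,
    λ x y x∈ y∈ → separates x y (∈-pair-swap x∈) (∈-pair-swap y∈)

module _ {V W : Set} {G : Rel V 0ℓ} {H : Rel W 0ℓ} (e : V ↔ W) where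
  open Inverse e using (to; from; strictlyInverseˡ; strictlyInverseʳ; inverseˡ)

  separatingTwoFactor-transport : (∀ {u v} → G u v → H (to u) (to v)) →
    ∀ {a b} → SeparatingTwoFactor G a b → SeparatingTwoFactor H (to a) (to b)
  separatingTwoFactor-transport hom {a} {b} (F , (F-sym , F⊆G , degree) , covers , separates) =
    F′ , ((λ x y → F-sym (from x) (from y)) , F′⊆H , degree′) , covers′ , separates′
    where
    F′ : Rel W 0ℓ
    F′ x y = F (from x) (from y)

    F⇒F′ : ∀ {u v} → F u v → F′ (to u) (to v)
    F⇒F′ = subst₂ F (sym (strictlyInverseʳ _)) (sym (strictlyInverseʳ _))

    F′⊆H : ∀ x y → F′ x y → H x y
    F′⊆H x y f = subst₂ H (strictlyInverseˡ x) (strictlyInverseˡ y) (hom (F⊆G _ _ f))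

    degree′ : ∀ x → ∃[ v ] ∃[ w ] (v ≢ w × F′ x v × F′ x w × (∀ y → F′ x y → y ≡ v ⊎ y ≡ w))
    degree′ x with degree (from x)
    ... | v , w , v≢w , Fv , Fw , only =
      to v , to w , v≢w ∘ to-injective , towards Fv , towards Fw ,
      λ y f → Sum.map (sym ∘ inverseˡ ∘ sym) (sym ∘ inverseˡ ∘ sym) (only (from y) f)
      where
      to-injective : ∀ {u v} → to u ≡ to v → u ≡ v
      to-injective {u} {v} eq = trans (sym (strictlyInverseʳ u)) (trans (cong from eq) (strictlyInverseʳ v))
      towards : ∀ {u} → F (from x) u → F′ x (to u)
      towards = subst (F (from x)) (sym (strictlyInverseʳ _))

    covers′ : ∀ x → ∃[ c ] (c ∈ to a ∷ to b ∷ [] × Star F′ c x)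
    covers′ x with covers (from x)
    ... | c , c∈ , walk =
      to c , ∈-map⁺ to c∈ , subst (Star F′ (to c)) (strictlyInverseˡ x) (Star.gmap to F⇒F′ walk)

    separates′ : ∀ x y → x ∈ to a ∷ to b ∷ [] → y ∈ to a ∷ to b ∷ [] → Star F′ x y → x ≡ y
    separates′ x y x∈ y∈ walk with ∈-map⁻ to x∈ | ∈-map⁻ to y∈
    ... | c , c∈ , refl | d , d∈ , refl =
      cong to (separates c d c∈ d∈
        (subst₂ (Star F) (strictlyInverseʳ c) (strictlyInverseʳ d) (Star.gmap from (λ f → f) walk)))

-- Hamiltonian cycles of vertex sets

Step : {V : Set} → (V → Set) → (V → V) → Rel V 0ℓ
Step D next x y = (D x × y ≡ next x) ⊎ (D y × x ≡ next y)

Step-sym : ∀ {V : Set} {D : V → Set} {next x y} → Step D next x y → Step D next y x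
Step-sym = Sum.swap

module _ {V : Set} (G : Rel V 0ℓ) where

  -- Encoded by its successor function: next≢prev rules out orbits of length at most two,
  -- and connected makes D a single orbit.
  record HamiltonianCycle (D : V → Set) : Set where
    field
      next prev     : V → V
      next-closed   : ∀ {u} → D u → D (next u)
      prev-closed   : ∀ {u} → D u → D (prev u)
      prev-next     : ∀ {u} → D u → prev (next u) ≡ u
      next-prev     : ∀ {u} → D u → next (prev u) ≡ u
      next-adjacent : ∀ {u} → D u → G u (next u)
      next≢prev     : ∀ {u} → D u → next u ≢ prev u
      start         : V
      connected     : ∀ {u} → D u → Star (Step D next) start u

module _ {V : Set} {G : Rel V 0ℓ} (G-sym : Symmetric G) {A B : V → Set}
         (A⊎B : ∀ u → A u ⊎ B u) (A∩B : ∀ {u} → A u → B u → ⊥)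
         (cycleA : HamiltonianCycle G A) (cycleB : HamiltonianCycle G B) where
  private
    module CA = HamiltonianCycle cycleA
    module CB = HamiltonianCycle cycleB

    glue : (V → V) → (V → V) → V → V
    glue f g u = [ (λ _ → f u) , (λ _ → g u) ]′ (A⊎B u)

    glue-A : ∀ f g {u} → A u → glue f g u ≡ f u
    glue-A _ _ {u} Au with A⊎B u
    ... | inj₁ _  = refl
    ... | inj₂ Bu = ⊥-elim (A∩B Au Bu)

    glue-B : ∀ f g {u} → B u → glue f g u ≡ g u
    glue-B _ _ {u} Bu with A⊎B u
    ... | inj₁ Au = ⊥-elim (A∩B Au Bu)
    ... | inj₂ _  = refl

    next prev : V → V
    next = glue CA.next CB.next
    prev = glue CA.prev CB.prev

    prev-next : ∀ u → prev (next u) ≡ u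
    prev-next u with A⊎B u
    ... | inj₁ Au = trans (glue-A CA.prev CB.prev (CA.next-closed Au)) (CA.prev-next Au)
    ... | inj₂ Bu = trans (glue-B CA.prev CB.prev (CB.next-closed Bu)) (CB.prev-next Bu)

    next-prev : ∀ u → next (prev u) ≡ u
    next-prev u with A⊎B u
    ... | inj₁ Au = trans (glue-A CA.next CB.next (CA.prev-closed Au)) (CA.next-prev Au)
    ... | inj₂ Bu = trans (glue-B CA.next CB.next (CB.prev-closed Bu)) (CB.next-prev Bu)

    next-adjacent : ∀ u → G u (next u)
    next-adjacent u with A⊎B u
    ... | inj₁ Au = CA.next-adjacent Au
    ... | inj₂ Bu = CB.next-adjacent Bu

    next≢prev : ∀ u → next u ≢ prev u
    next≢prev u with A⊎B u
    ... | inj₁ Au = CA.next≢prev Au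
    ... | inj₂ Bu = CB.next≢prev Bu

    F : Rel V 0ℓ
    F u v = v ≡ next u ⊎ u ≡ next v

    F-sym : ∀ {u v} → F u v → F v u
    F-sym = Sum.swap

    factor : IsTwoFactor G F
    factor = (λ _ _ → F-sym) , F⊆G ,
             λ u → next u , prev u , next≢prev u , inj₁ refl , inj₂ (sym (next-prev u)) , only u
      where
      F⊆G : ∀ u v → F u v → G u v
      F⊆G u _ (inj₁ refl) = next-adjacent u
      F⊆G _ v (inj₂ refl) = G-sym (next-adjacent v)
      only : ∀ u x → F u x → x ≡ next u ⊎ x ≡ prev u
      only u x (inj₁ x≡) = inj₁ x≡
      only _ x (inj₂ refl) = inj₂ (sym (prev-next x))

    F-preserves-A : ∀ {u v} → F u v → A u → A v
    F-preserves-A (inj₁ refl) Au = subst A (sym (glue-A CA.next CB.next Au)) (CA.next-closed Au)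
    F-preserves-A {v = v} (inj₂ refl) Anv with A⊎B v
    ... | inj₁ Av = Av
    ... | inj₂ Bv = ⊥-elim (A∩B Anv (CB.next-closed Bv))

    F-preserves-B : ∀ {u v} → F u v → B u → B v
    F-preserves-B {v = v} f Bu =
      [ (λ Av → ⊥-elim (A∩B (F-preserves-A (F-sym f) Av) Bu)) , (λ Bv → Bv) ]′ (A⊎B v)

    walk-preserves : ∀ {D : V → Set} → (∀ {u v} → F u v → D u → D v) → ∀ {u v} → Star F u v → D u → D v
    walk-preserves {D} preserves = Star.fold (λ u v → D u → D v) (λ f g → g ∘ preserves f) (λ Du → Du)

    Step⇒F : ∀ {D nextD} → (∀ {u} → D u → next u ≡ nextD u) → ∀ {x y} → Step D nextD x y → F x y
    Step⇒F agree (inj₁ (Dx , refl)) = inj₁ (sym (agree Dx))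
    Step⇒F agree (inj₂ (Dy , refl)) = inj₂ (sym (agree Dy))

    connect : ∀ {D} (cycle : HamiltonianCycle G D) → (∀ {u} → D u → next u ≡ HamiltonianCycle.next cycle u) →
           ∀ {x y} → D x → D y → Star F x y
    connect {D} cycle agree Dx Dy = Star.reverse F-sym (toF (connected Dx)) ◅◅ toF (connected Dy)
      where
      open HamiltonianCycle cycle using (connected)
      toF : ∀ {x y} → Star (Step D (HamiltonianCycle.next cycle)) x y → Star F x y
      toF = Star.map (Step⇒F agree)

  separatingTwoFactor-of-partition : ∀ {a b} → A a → B b → SeparatingTwoFactor G a b
  separatingTwoFactor-of-partition {a} {b} Aa Bb = F , factor , covers , separates
    where
    covers : ∀ x → ∃[ c ] (c ∈ a ∷ b ∷ [] × Star F c x)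
    covers x with A⊎B x
    ... | inj₁ Ax = a , here refl , connect cycleA (glue-A CA.next CB.next) Aa Ax
    ... | inj₂ Bx = b , there (here refl) , connect cycleB (glue-B CA.next CB.next) Bb Bx

    separates : ∀ x y → x ∈ a ∷ b ∷ [] → y ∈ a ∷ b ∷ [] → Star F x y → x ≡ y
    separates x y (here refl) (here refl) _ = refl
    separates x y (here refl) (there (here refl)) w = ⊥-elim (A∩B (walk-preserves F-preserves-A w Aa) Bb)
    separates x y (there (here refl)) (here refl) w = ⊥-elim (A∩B Aa (walk-preserves F-preserves-B w Bb))
    separates x y (there (here refl)) (there (here refl)) _ = refl

module _ {V P : Set} {G : Rel V 0ℓ} {E : Rel P 0ℓ} (ι : V → P) (κ : P → V)
         (κ∘ι : ∀ u → κ (ι u) ≡ u) (reflect : ∀ {u v} → E (ι u) (ι v) → G u v)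
         {D : P → Set} (ι∘κ : ∀ {p} → D p → ι (κ p) ≡ p) (cycle : HamiltonianCycle E D) where
  open HamiltonianCycle cycle

  private
    transfer : (P → P) → V → V
    transfer f u = κ (f (ι u))

    closed : ∀ {f} → (∀ {p} → D p → D (f p)) → ∀ {u} → D (ι u) → D (ι (transfer f u))
    closed {f} f-closed Du = subst D (sym (ι∘κ (f-closed Du))) (f-closed Du)

    inverse : ∀ f g → (∀ {p} → D p → D (f p)) → (∀ {p} → D p → g (f p) ≡ p) →
              ∀ {u} → D (ι u) → transfer g (transfer f u) ≡ u
    inverse f g f-closed g∘f {u} Du = begin
      κ (g (ι (κ (f (ι u))))) ≡⟨ cong (κ ∘ g) (ι∘κ (f-closed Du)) ⟩
      κ (g (f (ι u)))         ≡⟨ cong κ (g∘f Du) ⟩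
      κ (ι u)                 ≡⟨ κ∘ι u ⟩
      u                       ∎
      where open ≡-Reasoning

    lift-step : ∀ {p q} → Step D next p q → Step (D ∘ ι) (transfer next) (κ p) (κ q)
    lift-step (inj₁ (Dp , refl)) = inj₁ (subst D (sym (ι∘κ Dp)) Dp , cong (κ ∘ next) (sym (ι∘κ Dp)))
    lift-step (inj₂ (Dq , refl)) = inj₂ (subst D (sym (ι∘κ Dq)) Dq , cong (κ ∘ next) (sym (ι∘κ Dq)))

  hamiltonianCycle-pullback : HamiltonianCycle G (D ∘ ι)
  hamiltonianCycle-pullback = record
    { next          = transfer next
    ; prev          = transfer prev
    ; next-closed   = closed next-closed
    ; prev-closed   = closed prev-closed
    ; prev-next     = inverse next prev next-closed prev-next
    ; next-prev     = inverse prev next prev-closed next-prev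
    ; next-adjacent = λ Du → reflect (subst (E _) (sym (ι∘κ (next-closed Du))) (next-adjacent Du))
    ; next≢prev     = λ Du eq → next≢prev Du
        (trans (sym (ι∘κ (next-closed Du))) (trans (cong ι eq) (ι∘κ (prev-closed Du))))
    ; start         = κ start
    ; connected     = λ {u} Du → subst (Star _ (κ start)) (κ∘ι u) (Star.gmap κ lift-step (connected Du))
    }

module _ {V : Set} {R : Rel V 0ℓ} where

  Star-chain : (f : ℕ → V) → ∀ {a b} → a ≤ b →
               (∀ {k} → a ≤ k → k < b → R (f k) (f (suc k))) → Star R (f a) (f b)
  Star-chain f {b = zero} z≤n _ = ε
  Star-chain f {a} {suc b} a≤1+b steps with a ≤? b
  ... | yes a≤b = Star-chain f a≤b (λ a≤k k<b → steps a≤k (m<n⇒m<1+n k<b)) ◅◅ steps a≤b ≤-refl ◅ ε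
  ... | no a≰b with ≤-antisym a≤1+b (≰⇒> a≰b)
  ...   | refl = ε

Coord : Set
Coord = ℕ × ℕ

2+n≢n : ∀ {k} → suc (suc k) ≢ k
2+n≢n {k} = >⇒≢ (<-trans (n<1+n k) (n<1+n (suc k)))

<∧1+≮⇒1+≡ : ∀ {i m} → i < m → ¬ suc i < m → suc i ≡ m
<∧1+≮⇒1+≡ i<m 1+i≮m = ≤-antisym i<m (≮⇒≥ 1+i≮m)

pred[n]<n : ∀ {n} .{{_ : NonZero n}} → pred n < n
pred[n]<n {suc n} = ≤-refl

module _ {k d : ℕ} {{_ : NonZero d}} where

  [k+1]%d≡1+k : suc k < d → (k + 1) % d ≡ suc k
  [k+1]%d≡1+k 1+k<d = trans (cong (_% d) (+-comm k 1)) (m<n⇒m%n≡m 1+k<d)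

  [k+1]%d≡0 : suc k ≡ d → (k + 1) % d ≡ 0
  [k+1]%d≡0 refl = trans (cong (_% d) (+-comm k 1)) (n%n≡0 d)

  [k+0]%d≡k : k < d → (k + 0) % d ≡ k
  [k+0]%d≡k k<d = trans (cong (_% d) (+-identityʳ k)) (m<n⇒m%n≡m k<d)

InGrid : ℕ → ℕ → Coord → Set
InGrid m n (i , j) = i < m × j < n

module _ (m n ℓ : ℕ) {{_ : NonZero n}} where

  data GridEdge : Coord → Coord → Set where
    horiz : ∀ {i j j′}    → j′ ≡ (j + 1) % n → GridEdge (i , j) (i , j′)
    vert  : ∀ {i i′ j}    → i′ ≡ suc i → GridEdge (i , j) (i′ , j)
    jump  : ∀ {i i′ j j′} → suc i ≡ m → i′ ≡ 0 → j′ ≡ (j + ℓ) % n → GridEdge (i , j) (i′ , j′)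

  GridAdj : Coord → Coord → Set
  GridAdj p q = GridEdge p q ⊎ GridEdge q p

row col : ∀ {m n} → Fin m × Fin n → ℕ
row (i , _) = toℕ i
col (_ , j) = toℕ j

module _ {m n : ℕ} {{_ : NonZero m}} {{_ : NonZero n}} where

  coords : Fin m × Fin n → Coord
  coords (i , j) = toℕ i , toℕ j

  -- Reduces modulo the grid size, so it inverts coords only on InGrid.
  cell : Coord → Fin m × Fin n
  cell (i , j) = i mod m , j mod n

  coords-inGrid : ∀ u → InGrid m n (coords u)
  coords-inGrid (i , j) = toℕ<n i , toℕ<n j

  coords-injective : ∀ {u v} → coords u ≡ coords v → u ≡ v
  coords-injective {_ , _} {_ , _} eq =
    cong₂ _,_ (toℕ-injective (cong proj₁ eq)) (toℕ-injective (cong proj₂ eq))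

  coords-cell : ∀ {p} → InGrid m n p → coords (cell p) ≡ p
  coords-cell {i , j} (i<m , j<n) =
    cong₂ _,_ (trans (toℕ-fromℕ< _) (m<n⇒m%n≡m i<m)) (trans (toℕ-fromℕ< _) (m<n⇒m%n≡m j<n))

  cell-coords : ∀ u → cell (coords u) ≡ u
  cell-coords u = coords-injective (coords-cell (coords-inGrid u))

toℕ-addMod : ∀ {n} {{_ : NonZero n}} (j : Fin n) s → toℕ (addMod j s) ≡ (toℕ j + s) % n
toℕ-addMod {suc _} j s = toℕ-fromℕ< _

module _ {m n ℓ : ℕ} {{_ : NonZero m}} {{_ : NonZero n}} where

  edge⇒gridEdge : ∀ {u v} → Edge m n ℓ u v → GridEdge m n ℓ (coords u) (coords v)
  edge⇒gridEdge (horiz i j)          = horiz (toℕ-addMod j 1)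
  edge⇒gridEdge (vert i i′ j e)      = vert e
  edge⇒gridEdge (jump i i′ j e₁ e₂)  = jump e₁ e₂ (toℕ-addMod j ℓ)

  gridEdge⇒edge : ∀ {u v q} → GridEdge m n ℓ (coords u) q → coords v ≡ q → Edge m n ℓ u v
  gridEdge⇒edge {i , j} (horiz e) eq =
    subst (Edge m n ℓ (i , j))
      (coords-injective (trans (cong (toℕ i ,_) (trans (toℕ-addMod j 1) (sym e))) (sym eq))) (horiz i j)
  gridEdge⇒edge {i , j} {i′ , j′} (vert e) eq =
    subst (λ k → Edge m n ℓ (i , j) (i′ , k)) (toℕ-injective (sym (cong proj₂ eq)))
      (vert i i′ j (trans (cong proj₁ eq) e))
  gridEdge⇒edge {i , j} {i′ , j′} (jump e₁ e₂ e₃) eq =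
    subst (λ k → Edge m n ℓ (i , j) (i′ , k))
      (toℕ-injective (trans (toℕ-addMod j ℓ) (sym (trans (cong proj₂ eq) e₃))))
      (jump i i′ j e₁ (trans (cong proj₁ eq) e₂))

  gridAdj⇒adj : ∀ {u v} → GridAdj m n ℓ (coords u) (coords v) → Adj m n ℓ u v
  gridAdj⇒adj (inj₁ e) = inj₁ (gridEdge⇒edge e refl)
  gridAdj⇒adj (inj₂ e) = inj₂ (gridEdge⇒edge e refl)

module _ {m n ℓ : ℕ} {{_ : NonZero m}} {{_ : NonZero n}} where

  gridCycle⇒cycle : ∀ {D} → (∀ {p} → D p → InGrid m n p) →
                    HamiltonianCycle (GridAdj m n ℓ) D → HamiltonianCycle (Adj m n ℓ) (D ∘ coords)
  gridCycle⇒cycle D⊆grid = hamiltonianCycle-pullback coords cell cell-coords gridAdj⇒adj (coords-cell ∘ D⊆grid)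

  separatingTwoFactor-of-gridPartition : ∀ {A B} →
    (∀ {p} → InGrid m n p → A p ⊎ B p) → (∀ {p} → A p → B p → ⊥) →
    (∀ {p} → A p → InGrid m n p) → (∀ {p} → B p → InGrid m n p) →
    HamiltonianCycle (GridAdj m n ℓ) A → HamiltonianCycle (GridAdj m n ℓ) B →
    ∀ {a b} → A (coords a) → B (coords b) → SeparatingTwoFactor (Adj m n ℓ) a b
  separatingTwoFactor-of-gridPartition cover disjoint A⊆grid B⊆grid cycleA cycleB =
    separatingTwoFactor-of-partition Sum.swap (cover ∘ coords-inGrid) disjoint
      (gridCycle⇒cycle A⊆grid cycleA) (gridCycle⇒cycle B⊆grid cycleB)

module _ {m ℓ last : ℕ} where

  right : ∀ {i j} → j < last → GridEdge m (suc last) ℓ (i , j) (i , suc j)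
  right j<last = horiz (sym ([k+1]%d≡1+k (s≤s j<last)))

  wrap : ∀ {i} → GridEdge m (suc last) ℓ (i , last) (i , 0)
  wrap = horiz (sym ([k+1]%d≡0 {last} refl))

  down : ∀ {i j} → GridEdge m (suc last) ℓ (i , j) (suc i , j)
  down = vert refl

-- Symmetries of the grid

module _ (m n ℓ m′ n′ ℓ′ : ℕ)
         {{_ : NonZero m}} {{_ : NonZero n}} {{_ : NonZero m′}} {{_ : NonZero n′}} where

  record GridIso : Set where
    field
      to from     : Coord → Coord
      to-inGrid   : ∀ {p} → InGrid m n p → InGrid m′ n′ (to p)
      from-inGrid : ∀ {p} → InGrid m′ n′ p → InGrid m n (from p)
      from-to     : ∀ {p} → InGrid m n p → from (to p) ≡ p
      to-from     : ∀ {p} → InGrid m′ n′ p → to (from p) ≡ p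
      to-edge     : ∀ {p q} → InGrid m n p → InGrid m n q →
                    GridEdge m n ℓ p q → GridAdj m′ n′ ℓ′ (to p) (to q)

    toCell : Fin m × Fin n → Fin m′ × Fin n′
    toCell = cell ∘ to ∘ coords

    fromCell : Fin m′ × Fin n′ → Fin m × Fin n
    fromCell = cell ∘ from ∘ coords

    coords-toCell : ∀ u → coords (toCell u) ≡ to (coords u)
    coords-toCell u = coords-cell (to-inGrid (coords-inGrid u))

    coords-fromCell : ∀ v → coords (fromCell v) ≡ from (coords v)
    coords-fromCell v = coords-cell (from-inGrid (coords-inGrid v))

    cellIso : (Fin m × Fin n) ↔ (Fin m′ × Fin n′)
    cellIso = mk↔ₛ′ toCell fromCell
      (λ v → begin
        cell (to (coords (fromCell v))) ≡⟨ cong (cell ∘ to) (coords-fromCell v) ⟩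
        cell (to (from (coords v)))     ≡⟨ cong cell (to-from (coords-inGrid v)) ⟩
        cell (coords v)                 ≡⟨ cell-coords v ⟩
        v                               ∎)
      (λ u → begin
        cell (from (coords (toCell u))) ≡⟨ cong (cell ∘ from) (coords-toCell u) ⟩
        cell (from (to (coords u)))     ≡⟨ cong cell (from-to (coords-inGrid u)) ⟩
        cell (coords u)                 ≡⟨ cell-coords u ⟩
        u                               ∎)
      where open ≡-Reasoning

    toCell-edge : ∀ {u v} → Edge m n ℓ u v → Adj m′ n′ ℓ′ (toCell u) (toCell v)
    toCell-edge {u} {v} e = gridAdj⇒adj (subst₂ (GridAdj m′ n′ ℓ′) (sym (coords-toCell u)) (sym (coords-toCell v))
                                          (to-edge (coords-inGrid u) (coords-inGrid v) (edge⇒gridEdge e)))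

    transport : ∀ {a b} → SeparatingTwoFactor (Adj m n ℓ) (fromCell a) (fromCell b) →
                SeparatingTwoFactor (Adj m′ n′ ℓ′) a b
    transport = subst₂ (SeparatingTwoFactor _) (Inverse.strictlyInverseˡ cellIso _) (Inverse.strictlyInverseˡ cellIso _)
              ∘ separatingTwoFactor-transport cellIso
                  λ { (inj₁ e) → toCell-edge e ; (inj₂ e) → Sum.swap (toCell-edge e) }

    fromCell-injective : ∀ {a b} → fromCell a ≡ fromCell b → a ≡ b
    fromCell-injective {a} {b} eq = begin
      a                   ≡⟨ Inverse.strictlyInverseˡ cellIso a ⟨
      toCell (fromCell a) ≡⟨ cong toCell eq ⟩
      toCell (fromCell b) ≡⟨ Inverse.strictlyInverseˡ cellIso b ⟩
      b                   ∎
      where open ≡-Reasoning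

module _ {n : ℕ} {{_ : NonZero n}} where

  [m%n+k]%n≡[m+k]%n : ∀ a b → (a % n + b) % n ≡ (a + b) % n
  [m%n+k]%n≡[m+k]%n a b = begin
    (a % n + b) % n           ≡⟨ %-distribˡ-+ (a % n) b n ⟩
    (a % n % n + b % n) % n   ≡⟨ cong (λ x → (x + b % n) % n) (m%n%n≡m%n a n) ⟩
    (a % n + b % n) % n       ≡⟨ %-distribˡ-+ a b n ⟨
    (a + b) % n               ∎
    where open ≡-Reasoning

  [[m+k]%n+l]%n-comm : ∀ a b c → ((a + b) % n + c) % n ≡ ((a + c) % n + b) % n
  [[m+k]%n+l]%n-comm a b c = begin
    ((a + b) % n + c) % n ≡⟨ [m%n+k]%n≡[m+k]%n (a + b) c ⟩
    (a + b + c) % n       ≡⟨ cong (_% n) (xy∙z≈xz∙y a b c) ⟩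
    (a + c + b) % n       ≡⟨ [m%n+k]%n≡[m+k]%n (a + c) b ⟨
    ((a + c) % n + b) % n ∎
    where open ≡-Reasoning

  [[m+k]%n+l]%n≡m : ∀ {j s t} → s + t ≡ n → j < n → ((j + s) % n + t) % n ≡ j
  [[m+k]%n+l]%n≡m {j} {s} {t} s+t≡n j<n = begin
    ((j + s) % n + t) % n ≡⟨ [m%n+k]%n≡[m+k]%n (j + s) t ⟩
    (j + s + t) % n       ≡⟨ cong (_% n) (trans (+-assoc j s t) (cong (j +_) s+t≡n)) ⟩
    (j + n) % n           ≡⟨ [m+n]%n≡m%n j n ⟩
    j % n                 ≡⟨ m<n⇒m%n≡m j<n ⟩
    j                     ∎
    where open ≡-Reasoning

module _ {m n ℓ : ℕ} {{_ : NonZero m}} {{_ : NonZero n}} where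

  rotate : ℕ → Coord → Coord
  rotate s (i , j) = i , (j + s) % n

  rotate-edge : ∀ s {p q} → GridEdge m n ℓ p q → GridEdge m n ℓ (rotate s p) (rotate s q)
  rotate-edge s {_ , j} (horiz refl)         = horiz ([[m+k]%n+l]%n-comm j 1 s)
  rotate-edge s         (vert refl)          = vert refl
  rotate-edge s {_ , j} (jump e₁ e₂ refl)    = jump e₁ e₂ ([[m+k]%n+l]%n-comm j ℓ s)

  rotation : ∀ s t → s + t ≡ n → GridIso m n ℓ m n ℓ
  rotation s t s+t≡n = record
    { to          = rotate s
    ; from        = rotate t
    ; to-inGrid   = λ { {i , j} (i<m , _) → i<m , m%n<n (j + s) n }
    ; from-inGrid = λ { {i , j} (i<m , _) → i<m , m%n<n (j + t) n }
    ; from-to     = λ { {i , j} (_ , j<n) → cong (i ,_) ([[m+k]%n+l]%n≡m s+t≡n j<n) }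
    ; to-from     = λ { {i , j} (_ , j<n) → cong (i ,_) ([[m+k]%n+l]%n≡m (trans (+-comm t s) s+t≡n) j<n) }
    ; to-edge     = λ _ _ e → inj₁ (rotate-edge s e)
    }

  shiftRow : Coord → Coord
  shiftRow (i , j) with suc i <? m
  ... | yes _ = suc i , j
  ... | no _  = 0 , (j + ℓ) % n

  unshiftRow : Coord → Coord
  unshiftRow (zero , j)  = pred m , (j + (n ∸ ℓ)) % n
  unshiftRow (suc i , j) = i , j

  shiftRow-inner : ∀ {i j} → suc i < m → shiftRow (i , j) ≡ (suc i , j)
  shiftRow-inner {i} 1+i<m with suc i <? m
  ... | yes _    = refl
  ... | no 1+i≮m = contradiction 1+i<m 1+i≮m

  shiftRow-last : ∀ {i j} → suc i ≡ m → shiftRow (i , j) ≡ (0 , (j + ℓ) % n)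
  shiftRow-last {i} 1+i≡m with suc i <? m
  ... | yes 1+i<m = contradiction 1+i<m (<-irrefl 1+i≡m)
  ... | no _      = refl


  shiftRow-inGrid : ∀ {p} → InGrid m n p → InGrid m n (shiftRow p)
  shiftRow-inGrid {i , j} (_ , j<n) with suc i <? m
  ... | yes 1+i<m = 1+i<m , j<n
  ... | no _      = ≤-<-trans z≤n pred[n]<n , m%n<n (j + ℓ) n

  unshiftRow-inGrid : ∀ {p} → InGrid m n p → InGrid m n (unshiftRow p)
  unshiftRow-inGrid {zero , j} _               = pred[n]<n , m%n<n (j + (n ∸ ℓ)) n
  unshiftRow-inGrid {suc i , j} (1+i<m , j<n) = <-trans (n<1+n i) 1+i<m , j<n

  module _ (ℓ≤n : ℓ ≤ n) where

    unshiftRow∘shiftRow : ∀ {p} → InGrid m n p → unshiftRow (shiftRow p) ≡ p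
    unshiftRow∘shiftRow {i , j} (i<m , j<n) with suc i <? m
    ... | yes _    = refl
    ... | no 1+i≮m = cong₂ _,_ (cong pred (sym (<∧1+≮⇒1+≡ i<m 1+i≮m))) ([[m+k]%n+l]%n≡m (m+[n∸m]≡n ℓ≤n) j<n)

    shiftRow∘unshiftRow : ∀ {p} → InGrid m n p → shiftRow (unshiftRow p) ≡ p
    shiftRow∘unshiftRow {zero , j} (_ , j<n) =
      trans (shiftRow-last (suc-pred m))
            (cong (0 ,_) ([[m+k]%n+l]%n≡m (trans (+-comm (n ∸ ℓ) ℓ) (m+[n∸m]≡n ℓ≤n)) j<n))
    shiftRow∘unshiftRow {suc i , j} (1+i<m , _) = shiftRow-inner 1+i<m

  shiftRow-edge : 1 < m → ∀ {p q} → InGrid m n q → GridEdge m n ℓ p q → GridEdge m n ℓ (shiftRow p) (shiftRow q)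
  shiftRow-edge _ {i , j} _ (horiz e) with suc i <? m
  ... | yes _ = horiz e
  ... | no _  = horiz (trans (cong (λ x → (x + ℓ) % n) e) ([[m+k]%n+l]%n-comm j 1 ℓ))
  shiftRow-edge _ {i , j} (1+i<m , _) (vert refl) with suc i <? m | suc (suc i) <? m
  ... | no 1+i≮m | _     = contradiction 1+i<m 1+i≮m
  ... | yes _ | yes _    = vert refl
  ... | yes _ | no 2+i≮m = jump (<∧1+≮⇒1+≡ 1+i<m 2+i≮m) refl refl
  shiftRow-edge 1<m {i , j} _ (jump {j′ = j′} 1+i≡m refl e) =
    subst₂ (GridEdge m n ℓ) (sym (shiftRow-last 1+i≡m)) (sym (shiftRow-inner 1<m))
      (subst (λ x → GridEdge m n ℓ (0 , x) (1 , j′)) e (vert refl))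

  rowShift : 1 < m → ℓ ≤ n → GridIso m n ℓ m n ℓ
  rowShift 1<m ℓ≤n = record
    { to          = shiftRow
    ; from        = unshiftRow
    ; to-inGrid   = shiftRow-inGrid
    ; from-inGrid = unshiftRow-inGrid
    ; from-to     = unshiftRow∘shiftRow ℓ≤n
    ; to-from     = shiftRow∘unshiftRow ℓ≤n
    ; to-edge     = λ _ q∈ e → inj₁ (shiftRow-edge 1<m q∈ e)
    }

module _ {m n : ℕ} {{_ : NonZero m}} {{_ : NonZero n}} where

  transpose-edge : ∀ {p q} → InGrid m n p → InGrid m n q → GridEdge m n 0 p q → GridAdj n m 0 (swap p) (swap q)
  transpose-edge {i , j} (i<m , j<n) _ (horiz e) with suc j <? n
  ... | yes 1+j<n = inj₁ (vert (trans e ([k+1]%d≡1+k 1+j<n)))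
  ... | no 1+j≮n  = inj₁ (jump 1+j≡n (trans e ([k+1]%d≡0 1+j≡n)) (sym ([k+0]%d≡k i<m)))
    where
    1+j≡n : suc j ≡ n
    1+j≡n = <∧1+≮⇒1+≡ j<n 1+j≮n
  transpose-edge _ (i′<m , _) (vert e) = inj₁ (horiz (trans e (sym ([k+1]%d≡1+k (subst (_< m) e i′<m)))))
  transpose-edge {i , j} (_ , j<n) _ (jump {i′ = i′} e₁ e₂ e₃) =
    inj₁ (subst (λ x → GridEdge n m 0 (j , i) (x , i′)) (sym (trans e₃ ([k+0]%d≡k j<n)))
                (horiz (trans e₂ (sym ([k+1]%d≡0 e₁)))))

  transposition : GridIso m n 0 n m 0
  transposition = record
    { to          = swap
    ; from        = swap
    ; to-inGrid   = swap
    ; from-inGrid = swap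
    ; from-to     = λ _ → refl
    ; to-from     = λ _ → refl
    ; to-edge     = transpose-edge
    }

module _ {m : ℕ} where

  mirror : Fin m × Fin 3 → Fin m × Fin 3
  mirror (i , fzero)               = i , fzero
  mirror (i , fsuc fzero)          = i , fsuc (fsuc fzero)
  mirror (i , fsuc (fsuc fzero))   = i , fsuc fzero

  mirror-involutive : ∀ u → mirror (mirror u) ≡ u
  mirror-involutive (i , fzero)             = refl
  mirror-involutive (i , fsuc fzero)        = refl
  mirror-involutive (i , fsuc (fsuc fzero)) = refl

  mirror-edge : ∀ {u v} → Edge m 3 1 u v → Adj m 3 2 (mirror u) (mirror v)
  mirror-edge (horiz i fzero)                    = inj₂ (horiz i (fsuc (fsuc fzero)))
  mirror-edge (horiz i (fsuc fzero))             = inj₂ (horiz i (fsuc fzero))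
  mirror-edge (horiz i (fsuc (fsuc fzero)))      = inj₂ (horiz i fzero)
  mirror-edge (vert i i′ fzero e)                = inj₁ (vert i i′ fzero e)
  mirror-edge (vert i i′ (fsuc fzero) e)         = inj₁ (vert i i′ (fsuc (fsuc fzero)) e)
  mirror-edge (vert i i′ (fsuc (fsuc fzero)) e)  = inj₁ (vert i i′ (fsuc fzero) e)
  mirror-edge (jump i i′ fzero e₁ e₂)               = inj₁ (jump i i′ fzero e₁ e₂)
  mirror-edge (jump i i′ (fsuc fzero) e₁ e₂)        = inj₁ (jump i i′ (fsuc (fsuc fzero)) e₁ e₂)
  mirror-edge (jump i i′ (fsuc (fsuc fzero)) e₁ e₂) = inj₁ (jump i i′ (fsuc fzero) e₁ e₂)

  separatingTwoFactor-mirror : ∀ {a b} → SeparatingTwoFactor (Adj m 3 1) (mirror a) (mirror b) →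
                               SeparatingTwoFactor (Adj m 3 2) a b
  separatingTwoFactor-mirror {a} {b} =
    subst₂ (SeparatingTwoFactor (Adj m 3 2)) (mirror-involutive a) (mirror-involutive b) ∘
    separatingTwoFactor-transport (mk↔ₛ′ mirror mirror mirror-involutive mirror-involutive)
      λ { (inj₁ e) → mirror-edge e ; (inj₂ e) → Sum.swap (mirror-edge e) }

  mirror-injective : ∀ {u v} → mirror u ≡ mirror v → u ≡ v
  mirror-injective {u} {v} eq = trans (sym (mirror-involutive u)) (trans (cong mirror eq) (mirror-involutive v))

  row-mirror : ∀ u → row (mirror u) ≡ row u
  row-mirror (i , fzero)             = refl
  row-mirror (i , fsuc fzero)        = refl
  row-mirror (i , fsuc (fsuc fzero)) = refl

-- Combs: cells in different rows

-- The comb on the rows lo … hi: down the spine (column 0) from (lo , 0) to (hi , 0), then back up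
-- through the rows hi, …, lo, each traversed over the columns 1 … last and turning in column 1 or
-- column last. A row runs rightwards iff its distance to row lo is even, so that row lo ends in
-- (lo , last) and the wrap-around edge to (lo , 0) closes the cycle.
module Comb (last lo hi : ℕ) where

  Rows : Coord → Set
  Rows (i , j) = lo ≤ i × i ≤ hi × j ≤ last

  direction : ℕ → Parity
  direction i = parity (i ∸ lo)

  next : Coord → Coord
  next (i , zero) with i <? hi | direction i
  ... | yes _ | _  = suc i , 0
  ... | no _  | 0ℙ = i , 1
  ... | no _  | 1ℙ = i , last
  next (i , suc j) with direction i
  next (i , suc zero)    | 1ℙ = pred i , 1
  next (i , suc (suc j)) | 1ℙ = i , suc j
  next (i , suc j)       | 0ℙ with suc j <? last | lo <? i
  ... | yes _ | _     = i , suc (suc j)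
  ... | no _  | yes _ = pred i , last
  ... | no _  | no _  = i , 0

  prev : Coord → Coord
  prev (i , zero) with lo <? i
  ... | yes _ = pred i , 0
  ... | no _  = i , last
  prev (i , suc j) with direction i
  prev (i , suc zero)    | 0ℙ with i <? hi
  ... | yes _ = suc i , 1
  ... | no _  = i , 0
  prev (i , suc (suc j)) | 0ℙ = i , suc j
  prev (i , suc j)       | 1ℙ with suc j <? last | i <? hi
  ... | yes _ | _     = i , suc (suc j)
  ... | no _  | yes _ = suc i , last
  ... | no _  | no _  = i , 0

  next-spine : ∀ {i} → i < hi → next (i , 0) ≡ (suc i , 0)
  next-spine {i} i<hi with i <? hi
  ... | yes _   = refl
  ... | no i≮hi = contradiction i<hi i≮hi

  next-turn₀ : ∀ {i} → ¬ i < hi → direction i ≡ 0ℙ → next (i , 0) ≡ (i , 1)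
  next-turn₀ {i} i≮hi d with i <? hi
  ... | yes i<hi = contradiction i<hi i≮hi
  ... | no _ rewrite d = refl

  next-turn₁ : ∀ {i} → ¬ i < hi → direction i ≡ 1ℙ → next (i , 0) ≡ (i , last)
  next-turn₁ {i} i≮hi d with i <? hi
  ... | yes i<hi = contradiction i<hi i≮hi
  ... | no _ rewrite d = refl

  next-right : ∀ {i j} → direction i ≡ 0ℙ → suc j < last → next (i , suc j) ≡ (i , suc (suc j))
  next-right {i} {j} d j<last rewrite d with suc j <? last
  ... | yes _     = refl
  ... | no j≮last = contradiction j<last j≮last

  next-up₀ : ∀ {i j} → direction i ≡ 0ℙ → suc j ≡ last → lo < i → next (i , suc j) ≡ (pred i , last)
  next-up₀ {i} {j} d j≡last lo<i rewrite d with suc j <? last | lo <? i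
  ... | yes j<last | _   = contradiction j<last (<-irrefl j≡last)
  ... | no _ | yes _     = refl
  ... | no _ | no lo≮i   = contradiction lo<i lo≮i

  next-wrap : ∀ {i j} → direction i ≡ 0ℙ → suc j ≡ last → ¬ lo < i → next (i , suc j) ≡ (i , 0)
  next-wrap {i} {j} d j≡last lo≮i rewrite d with suc j <? last | lo <? i
  ... | yes j<last | _ = contradiction j<last (<-irrefl j≡last)
  ... | no _ | yes lo<i = contradiction lo<i lo≮i
  ... | no _ | no _     = refl

  next-up₁ : ∀ {i} → direction i ≡ 1ℙ → next (i , 1) ≡ (pred i , 1)
  next-up₁ d rewrite d = refl

  next-left : ∀ {i j} → direction i ≡ 1ℙ → next (i , suc (suc j)) ≡ (i , suc j)
  next-left d rewrite d = refl

  prev-spine : ∀ {i} → lo < i → prev (i , 0) ≡ (pred i , 0)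
  prev-spine {i} lo<i with lo <? i
  ... | yes _   = refl
  ... | no lo≮i = contradiction lo<i lo≮i

  prev-wrap : ∀ {i} → ¬ lo < i → prev (i , 0) ≡ (i , last)
  prev-wrap {i} lo≮i with lo <? i
  ... | yes lo<i = contradiction lo<i lo≮i
  ... | no _     = refl

  prev-left : ∀ {i j} → direction i ≡ 0ℙ → prev (i , suc (suc j)) ≡ (i , suc j)
  prev-left d rewrite d = refl

  prev-below₀ : ∀ {i} → direction i ≡ 0ℙ → i < hi → prev (i , 1) ≡ (suc i , 1)
  prev-below₀ {i} d i<hi rewrite d with i <? hi
  ... | yes _   = refl
  ... | no i≮hi = contradiction i<hi i≮hi

  prev-turn₀ : ∀ {i} → direction i ≡ 0ℙ → ¬ i < hi → prev (i , 1) ≡ (i , 0)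
  prev-turn₀ {i} d i≮hi rewrite d with i <? hi
  ... | yes i<hi = contradiction i<hi i≮hi
  ... | no _     = refl

  prev-right : ∀ {i j} → direction i ≡ 1ℙ → suc j < last → prev (i , suc j) ≡ (i , suc (suc j))
  prev-right {i} {j} d j<last rewrite d with suc j <? last
  ... | yes _     = refl
  ... | no j≮last = contradiction j<last j≮last

  prev-below₁ : ∀ {i j} → direction i ≡ 1ℙ → suc j ≡ last → i < hi → prev (i , suc j) ≡ (suc i , last)
  prev-below₁ {i} {j} d j≡last i<hi rewrite d with suc j <? last | i <? hi
  ... | yes j<last | _ = contradiction j<last (<-irrefl j≡last)
  ... | no _ | yes _    = refl
  ... | no _ | no i≮hi  = contradiction i<hi i≮hi

  prev-turn₁ : ∀ {i j} → direction i ≡ 1ℙ → suc j ≡ last → ¬ i < hi → prev (i , suc j) ≡ (i , 0)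
  prev-turn₁ {i} {j} d j≡last i≮hi rewrite d with suc j <? last | i <? hi
  ... | yes j<last | _ = contradiction j<last (<-irrefl j≡last)
  ... | no _ | yes i<hi = contradiction i<hi i≮hi
  ... | no _ | no _     = refl

  module Properties (2≤last : 2 ≤ last) where

    direction-lo : direction lo ≡ 0ℙ
    direction-lo = cong parity (n∸n≡0 lo)

    direction-suc : ∀ {i} → lo ≤ i → direction (suc i) ≡ direction i ⁻¹
    direction-suc {i} lo≤i =
      trans (cong parity (+-∸-assoc 1 lo≤i)) (sym (⁻¹-selfInverse (suc-homo-⁻¹ (i ∸ lo))))

    direction-suc⁺ : ∀ {i p} → lo ≤ i → direction i ≡ p → direction (suc i) ≡ p ⁻¹
    direction-suc⁺ lo≤i d = trans (direction-suc lo≤i) (cong _⁻¹ d)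

    direction-suc⁻ : ∀ {i p} → lo ≤ i → direction (suc i) ≡ p → direction i ≡ p ⁻¹
    direction-suc⁻ lo≤i d = sym (⁻¹-selfInverse (trans (sym (direction-suc lo≤i)) d))

    lo<-of-1ℙ : ∀ {i} → lo ≤ i → direction i ≡ 1ℙ → lo < i
    lo<-of-1ℙ lo≤i d with m≤n⇒m<n∨m≡n lo≤i
    ... | inj₁ lo<i = lo<i
    ... | inj₂ refl with trans (sym direction-lo) d
    ... | ()

    row-above : ∀ {i} → lo < i → ∃[ i′ ] (i ≡ suc i′ × lo ≤ i′)
    row-above {suc i} (s≤s lo≤i) = i , refl , lo≤i

    1≤last : 1 ≤ last
    1≤last = ≤-trans (s≤s z≤n) 2≤last

    last≡suc : suc (pred last) ≡ last
    last≡suc = suc-pred last {{>-nonZero 1≤last}}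

    0≢last : 0 ≢ last
    0≢last refl = contradiction 2≤last λ ()

    1≢last : 1 ≢ last
    1≢last refl = contradiction 2≤last λ { (s≤s ()) }


    prev-next : ∀ {p} → Rows p → prev (next p) ≡ p
    prev-next {i , zero} (lo≤i , _ , _) with i <? hi
    ... | yes _ = prev-spine (s≤s lo≤i)
    ... | no i≮hi with direction i in d
    ...   | 0ℙ = prev-turn₀ d i≮hi
    ...   | 1ℙ = trans (cong (λ x → prev (i , x)) (sym last≡suc)) (prev-turn₁ d last≡suc i≮hi)
    prev-next {i , suc j} (lo≤i , i≤hi , j≤last) with direction i in d
    prev-next {i , suc zero} (lo≤i , i≤hi , _) | 1ℙ with row-above (lo<-of-1ℙ lo≤i d)
    ... | i′ , refl , lo≤i′ = prev-below₀ (direction-suc⁻ lo≤i′ d) i≤hi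
    prev-next {i , suc (suc j)} (_ , _ , j≤last) | 1ℙ = prev-right d j≤last
    prev-next {i , suc j} (lo≤i , i≤hi , j≤last) | 0ℙ with suc j <? last
    ... | yes _ = prev-left d
    ... | no j≮last with <∧1+≮⇒1+≡ j≤last j≮last | lo <? i
    ...   | j≡last | no lo≮i = trans (prev-wrap lo≮i) (cong (i ,_) (sym j≡last))
    ...   | j≡last | yes lo<i with row-above lo<i
    ...     | i′ , refl , lo≤i′ = begin
      prev (i′ , last)   ≡⟨ cong (λ x → prev (i′ , x)) (sym j≡last) ⟩
      prev (i′ , suc j)  ≡⟨ prev-below₁ (direction-suc⁻ lo≤i′ d) j≡last i≤hi ⟩
      (suc i′ , last)    ≡⟨ cong (suc i′ ,_) (sym j≡last) ⟩
      (suc i′ , suc j)   ∎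
      where open ≡-Reasoning

    next-prev : ∀ {p} → Rows p → next (prev p) ≡ p
    next-prev {i , zero} (lo≤i , i≤hi , _) with lo <? i
    ... | yes lo<i with row-above lo<i
    ...   | i′ , refl , _ = next-spine i≤hi
    next-prev {i , zero} (lo≤i , i≤hi , _) | no lo≮i with ≤-antisym lo≤i (≮⇒≥ lo≮i)
    ... | refl = trans (cong (λ x → next (i , x)) (sym last≡suc)) (next-wrap direction-lo last≡suc lo≮i)
    next-prev {i , suc j} (lo≤i , i≤hi , j≤last) with direction i in d
    next-prev {i , suc zero} (lo≤i , i≤hi , _) | 0ℙ with i <? hi
    ... | yes _   = next-up₁ (direction-suc⁺ lo≤i d)
    ... | no i≮hi = next-turn₀ i≮hi d
    next-prev {i , suc (suc j)} (_ , _ , j≤last) | 0ℙ = next-right d j≤last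
    next-prev {i , suc j} (lo≤i , i≤hi , j≤last) | 1ℙ with suc j <? last
    ... | yes _ = next-left d
    ... | no j≮last with <∧1+≮⇒1+≡ j≤last j≮last | i <? hi
    ...   | j≡last | yes _ = begin
      next (suc i , last)  ≡⟨ cong (λ x → next (suc i , x)) (sym j≡last) ⟩
      next (suc i , suc j) ≡⟨ next-up₀ (direction-suc⁺ lo≤i d) j≡last (s≤s lo≤i) ⟩
      (i , last)           ≡⟨ cong (i ,_) (sym j≡last) ⟩
      (i , suc j)          ∎
      where open ≡-Reasoning
    ...   | j≡last | no i≮hi = trans (next-turn₁ i≮hi d) (cong (i ,_) (sym j≡last))

    next-step : ∀ {m ℓ p} → Rows p → Rows (next p) × GridAdj m (suc last) ℓ p (next p)
    next-step {p = i , zero} (lo≤i , i≤hi , _) with i <? hi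
    ... | yes i<hi = (≤-trans lo≤i (n≤1+n i) , i<hi , z≤n) , inj₁ down
    ... | no _ with direction i
    ...   | 0ℙ = (lo≤i , i≤hi , 1≤last) , inj₁ (right (1≤last))
    ...   | 1ℙ = (lo≤i , i≤hi , ≤-refl) , inj₂ wrap
    next-step {p = i , suc j} (lo≤i , i≤hi , j≤last) with direction i in d
    next-step {p = i , suc zero} (lo≤i , i≤hi , _) | 1ℙ with row-above (lo<-of-1ℙ lo≤i d)
    ... | i′ , refl , lo≤i′ = (lo≤i′ , ≤-trans (n≤1+n i′) i≤hi , 1≤last) , inj₂ down
    next-step {p = i , suc (suc j)} (lo≤i , i≤hi , j≤last) | 1ℙ = (lo≤i , i≤hi , <⇒≤ j≤last) , inj₂ (right j≤last)
    next-step {p = i , suc j} (lo≤i , i≤hi , j≤last) | 0ℙ with suc j <? last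
    ... | yes j<last = (lo≤i , i≤hi , j<last) , inj₁ (right j<last)
    ... | no j≮last with <∧1+≮⇒1+≡ j≤last j≮last | lo <? i
    ...   | refl | no _ = (lo≤i , i≤hi , z≤n) , inj₁ wrap
    ...   | refl | yes lo<i with row-above lo<i
    ...     | i′ , refl , lo≤i′ = (lo≤i′ , ≤-trans (n≤1+n i′) i≤hi , ≤-refl) , inj₂ down

    prev-closed : ∀ {p} → Rows p → Rows (prev p)
    prev-closed {i , zero} (lo≤i , i≤hi , _) with lo <? i
    ... | no _ = lo≤i , i≤hi , ≤-refl
    ... | yes lo<i with row-above lo<i
    ...   | i′ , refl , lo≤i′ = lo≤i′ , ≤-trans (n≤1+n i′) i≤hi , z≤n
    prev-closed {i , suc j} (lo≤i , i≤hi , j≤last) with direction i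
    prev-closed {i , suc zero} (lo≤i , i≤hi , j≤last) | 0ℙ with i <? hi
    ... | yes i<hi = ≤-trans lo≤i (n≤1+n i) , i<hi , j≤last
    ... | no _     = lo≤i , i≤hi , z≤n
    prev-closed {i , suc (suc j)} (lo≤i , i≤hi , j≤last) | 0ℙ = lo≤i , i≤hi , <⇒≤ j≤last
    prev-closed {i , suc j} (lo≤i , i≤hi , j≤last) | 1ℙ with suc j <? last | i <? hi
    ... | yes j<last | _ = lo≤i , i≤hi , j<last
    ... | no _ | yes i<hi = ≤-trans lo≤i (n≤1+n i) , i<hi , ≤-refl
    ... | no _ | no _     = lo≤i , i≤hi , z≤n

    next≢prev : ∀ {p} → Rows p → next p ≢ prev p
    next≢prev {i , zero} (lo≤i , _ , _) with i <? hi | lo <? i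
    ... | yes _ | yes lo<i with row-above lo<i
    ...   | i′ , refl , _ = λ e → 2+n≢n (,-injectiveˡ e)
    next≢prev {i , zero} _ | yes _ | no _ = λ e → 0≢last (,-injectiveʳ e)
    next≢prev {i , zero} (lo≤i , _ , _) | no _ | lo<i? with direction i in d | lo<i?
    ... | 0ℙ | yes _ = λ ()
    ... | 0ℙ | no _  = λ e → 1≢last (,-injectiveʳ e)
    ... | 1ℙ | yes _ = λ e → 0≢last (sym (,-injectiveʳ e))
    ... | 1ℙ | no lo≮i = contradiction (lo<-of-1ℙ lo≤i d) lo≮i
    next≢prev {i , suc j} (lo≤i , i≤hi , j≤last) with direction i
    next≢prev {i , suc zero} _ | 1ℙ with 1 <? last
    ... | yes _    = λ ()
    ... | no 1≮last = contradiction 2≤last 1≮last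
    next≢prev {i , suc (suc j)} _ | 1ℙ with suc (suc j) <? last | i <? hi
    ... | yes _ | _ = λ e → 2+n≢n (sym (suc-injective (,-injectiveʳ e)))
    ... | no _ | yes _ = λ e → 1+n≢n (sym (,-injectiveˡ e))
    ... | no _ | no _  = λ ()
    next≢prev {i , suc zero} _ | 0ℙ with 1 <? last | i <? hi
    ... | yes _ | yes _ = λ ()
    ... | yes _ | no _  = λ ()
    ... | no 1≮last | _ = contradiction 2≤last 1≮last
    next≢prev {i , suc (suc j)} _ | 0ℙ with suc (suc j) <? last | lo <? i
    ... | yes _ | _ = λ e → 2+n≢n (suc-injective (,-injectiveʳ e))
    ... | no _ | yes lo<i with row-above lo<i
    ...   | i′ , refl , _ = λ e → 1+n≢n (sym (,-injectiveˡ e))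
    next≢prev {i , suc (suc j)} _ | 0ℙ | no _ | no _ = λ ()

    -- Stated for any next′ agreeing with the comb on the spine and on the rows r₀ … hi, so that it
    -- also serves the chorded comb below.
    module Walks {D : Coord → Set} {next′ : Coord → Coord} (r₀ : ℕ) (lo≤r₀ : lo ≤ r₀)
      (spine-agrees : ∀ {i} → lo ≤ i → i < hi → D (i , 0) × next′ (i , 0) ≡ next (i , 0))
      (rows-agree : ∀ {i j} → r₀ ≤ i → i ≤ hi → j ≤ last → D (i , j) × next′ (i , j) ≡ next (i , j)) where

      Walk : Coord → Coord → Set
      Walk = Star (Step D next′)

      forward : ∀ {p q} → D p × next′ p ≡ next p → next p ≡ q → Step D next′ p q
      forward (Dp , agree) e = inj₁ (Dp , sym (trans agree e))

      backward : ∀ {p q} → D q × next′ q ≡ next q → next q ≡ p → Step D next′ p q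
      backward (Dq , agree) e = inj₂ (Dq , sym (trans agree e))

      spine : ∀ {i} → lo ≤ i → i ≤ hi → Walk (lo , 0) (i , 0)
      spine lo≤i i≤hi = Star-chain (λ k → k , 0) lo≤i λ lo≤k k<i →
        forward (spine-agrees lo≤k (<-≤-trans k<i i≤hi)) (next-spine (<-≤-trans k<i i≤hi))

      along-row : ∀ {i j} → r₀ ≤ i → i ≤ hi → 1 ≤ j → j ≤ last → Walk (i , 1) (i , j)
      along-row {i} r₀≤i i≤hi 1≤j j≤last = Star-chain (λ k → i , k) 1≤j λ 1≤k k<j → step 1≤k (<-≤-trans k<j j≤last)
        where
        step : ∀ {k} → 1 ≤ k → k < last → Step D next′ (i , k) (i , suc k)
        step {suc k} _ k<last with direction i in d
        ... | 0ℙ = forward (rows-agree r₀≤i i≤hi (<⇒≤ k<last)) (next-right d k<last)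
        ... | 1ℙ = backward (rows-agree r₀≤i i≤hi k<last) (next-left d)

      within-row : ∀ {i j j′} → r₀ ≤ i → i ≤ hi → 1 ≤ j → j ≤ last → 1 ≤ j′ → j′ ≤ last → Walk (i , j) (i , j′)
      within-row r₀≤i i≤hi 1≤j j≤last 1≤j′ j′≤last =
        Star.reverse Step-sym (along-row r₀≤i i≤hi 1≤j j≤last) ◅◅ along-row r₀≤i i≤hi 1≤j′ j′≤last

      enter-row : ∀ k {i} → k + i ≡ hi → r₀ ≤ i → Walk (lo , 0) (i , 1)
      enter-row zero {i} refl r₀≤i = spine (≤-trans lo≤r₀ r₀≤i) ≤-refl ◅◅ turn (direction i) refl
        where
        turn : ∀ p → direction i ≡ p → Walk (i , 0) (i , 1)
        turn 0ℙ d = forward (rows-agree r₀≤i ≤-refl z≤n) (next-turn₀ (<-irrefl refl) d) ◅ ε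
        turn 1ℙ d = forward (rows-agree r₀≤i ≤-refl z≤n) (next-turn₁ (<-irrefl refl) d)
                    ◅ within-row r₀≤i ≤-refl 1≤last ≤-refl ≤-refl 1≤last
      enter-row (suc k) {i} k+i≡hi r₀≤i =
        enter-row k (trans (+-suc k i) k+i≡hi) r₀≤1+i ◅◅ up-a-row (direction (suc i)) refl
        where
        r₀≤1+i : r₀ ≤ suc i
        r₀≤1+i = ≤-trans r₀≤i (n≤1+n i)
        1+i≤hi : suc i ≤ hi
        1+i≤hi = subst (suc i ≤_) k+i≡hi (s≤s (m≤n+m i k))

        up-a-row : ∀ p → direction (suc i) ≡ p → Walk (suc i , 1) (i , 1)
        up-a-row 1ℙ d = forward (rows-agree r₀≤1+i 1+i≤hi 1≤last) (next-up₁ d) ◅ ε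
        up-a-row 0ℙ d =
          within-row r₀≤1+i 1+i≤hi ≤-refl 1≤last 1≤last ≤-refl
          ◅◅ forward (rows-agree r₀≤1+i 1+i≤hi ≤-refl) up
          ◅ within-row r₀≤i (<⇒≤ 1+i≤hi) 1≤last ≤-refl ≤-refl 1≤last
          where
          up : next (suc i , last) ≡ (i , last)
          up = trans (cong (λ x → next (suc i , x)) (sym last≡suc))
                     (next-up₀ d last≡suc (s≤s (≤-trans lo≤r₀ r₀≤i)))

      reach : ∀ {i j} → r₀ ≤ i → i ≤ hi → j ≤ last → Walk (lo , 0) (i , j)
      reach {i} {zero} r₀≤i i≤hi _ = spine (≤-trans lo≤r₀ r₀≤i) i≤hi
      reach {i} {suc j} r₀≤i i≤hi j≤last =
        enter-row (hi ∸ i) (m∸n+n≡m i≤hi) r₀≤i ◅◅ within-row r₀≤i i≤hi ≤-refl 1≤last (s≤s z≤n) j≤last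

  comb : ∀ {m ℓ} → 2 ≤ last → HamiltonianCycle (GridAdj m (suc last) ℓ) Rows
  comb {m} {ℓ} 2≤last = record
    { next          = next
    ; prev          = prev
    ; next-closed   = λ r → proj₁ (next-step {m} {ℓ} r)
    ; prev-closed   = prev-closed
    ; prev-next     = prev-next
    ; next-prev     = next-prev
    ; next-adjacent = proj₂ ∘ next-step
    ; next≢prev     = next≢prev
    ; start         = lo , 0
    ; connected     = λ (lo≤i , i≤hi , j≤last) → reach lo≤i i≤hi j≤last
    }
    where
    open Properties 2≤last
    open Walks lo ≤-refl (λ lo≤i i<hi → (lo≤i , <⇒≤ i<hi , z≤n) , refl)
                         (λ lo≤i i≤hi j≤last → (lo≤i , i≤hi , j≤last) , refl)

separatingTwoFactor-of-row< : ∀ {m last ℓ} {{_ : NonZero m}} → 2 ≤ last →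
  ∀ {a b : Fin m × Fin (suc last)} → row a < row b → SeparatingTwoFactor (Adj m (suc last) ℓ) a b
separatingTwoFactor-of-row< {m} {last} 2≤last {a} {b} ra<rb =
  separatingTwoFactor-of-gridPartition cover disjoint
    (λ (_ , i≤ra , j≤last) → ≤-<-trans i≤ra (<-trans ra<rb (toℕ<n (proj₁ b))) , s≤s j≤last)
    (λ (_ , i≤pred-m , j≤last) → ≤-<-trans i≤pred-m pred[n]<n , s≤s j≤last)
    (Comb.comb last 0 (row a) 2≤last) (Comb.comb last (suc (row a)) (pred m) 2≤last)
    (z≤n , ≤-refl , ≤-pred (toℕ<n (proj₂ a))) (ra<rb , <⇒≤pred (toℕ<n (proj₁ b)) , ≤-pred (toℕ<n (proj₂ b)))
  where
  Above Below : Coord → Set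
  Above = Comb.Rows last 0 (row a)
  Below = Comb.Rows last (suc (row a)) (pred m)

  cover : ∀ {p} → InGrid m (suc last) p → Above p ⊎ Below p
  cover {i , j} (i<m , j<n) with i ≤? row a
  ... | yes i≤ra = inj₁ (z≤n , i≤ra , ≤-pred j<n)
  ... | no i≰ra  = inj₂ (≰⇒> i≰ra , <⇒≤pred i<m , ≤-pred j<n)

  disjoint : ∀ {p} → Above p → Below p → ⊥
  disjoint (_ , i≤ra , _) (ra<i , _ , _) = <⇒≱ ra<i i≤ra

module _ {m last ℓ : ℕ} {{_ : NonZero m}} (2≤last : 2 ≤ last) where

  separatingTwoFactor-of-row≢ : ∀ {a b : Fin m × Fin (suc last)} → row a ≢ row b →
                                SeparatingTwoFactor (Adj m (suc last) ℓ) a b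
  separatingTwoFactor-of-row≢ {a} {b} ra≢rb with <-cmp (row a) (row b)
  ... | tri< ra<rb _ _ = separatingTwoFactor-of-row< 2≤last ra<rb
  ... | tri≈ _ ra≡rb _ = contradiction ra≡rb ra≢rb
  ... | tri> _ _ rb<ra = separatingTwoFactor-sym (separatingTwoFactor-of-row< 2≤last rb<ra)

-- Cutting off a square: cells in a common row

Square : Coord → Set
Square (i , j) = i ≤ 1 × 1 ≤ j × j ≤ 2

data Corner : Coord → Set where
  c₀₁ : Corner (0 , 1)
  c₀₂ : Corner (0 , 2)
  c₁₂ : Corner (1 , 2)
  c₁₁ : Corner (1 , 1)

corner : ∀ {p} → Square p → Corner p
corner {0 , 1} _ = c₀₁
corner {0 , 2} _ = c₀₂
corner {1 , 1} _ = c₁₁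
corner {1 , 2} _ = c₁₂
corner {_ , 0} (_ , () , _)
corner {_ , suc (suc (suc _))} (_ , _ , s≤s (s≤s ()))
corner {suc (suc _) , _} (s≤s () , _ , _)

corner⇒square : ∀ {p} → Corner p → Square p
corner⇒square c₀₁ = z≤n , s≤s z≤n , s≤s z≤n
corner⇒square c₀₂ = z≤n , s≤s z≤n , ≤-refl
corner⇒square c₁₂ = ≤-refl , s≤s z≤n , ≤-refl
corner⇒square c₁₁ = ≤-refl , s≤s z≤n , s≤s z≤n

squareNext squarePrev : Coord → Coord
squareNext (0 , 1) = 0 , 2
squareNext (0 , 2) = 1 , 2
squareNext (1 , 2) = 1 , 1
squareNext p       = 0 , 1

squarePrev (0 , 2) = 0 , 1
squarePrev (1 , 2) = 0 , 2
squarePrev (1 , 1) = 1 , 2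
squarePrev p       = 1 , 1

corner-next : ∀ {p} → Corner p → Corner (squareNext p)
corner-next c₀₁ = c₀₂
corner-next c₀₂ = c₁₂
corner-next c₁₂ = c₁₁
corner-next c₁₁ = c₀₁

corner-prev : ∀ {p} → Corner p → Corner (squarePrev p)
corner-prev c₀₁ = c₁₁
corner-prev c₀₂ = c₀₁
corner-prev c₁₂ = c₀₂
corner-prev c₁₁ = c₁₂

squarePrev∘squareNext : ∀ {p} → Corner p → squarePrev (squareNext p) ≡ p
squarePrev∘squareNext c₀₁ = refl
squarePrev∘squareNext c₀₂ = refl
squarePrev∘squareNext c₁₂ = refl
squarePrev∘squareNext c₁₁ = refl

squareNext∘squarePrev : ∀ {p} → Corner p → squareNext (squarePrev p) ≡ p
squareNext∘squarePrev c₀₁ = refl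
squareNext∘squarePrev c₀₂ = refl
squareNext∘squarePrev c₁₂ = refl
squareNext∘squarePrev c₁₁ = refl

squareNext≢squarePrev : ∀ {p} → Corner p → squareNext p ≢ squarePrev p
squareNext≢squarePrev c₀₁ ()
squareNext≢squarePrev c₀₂ ()
squareNext≢squarePrev c₁₂ ()
squareNext≢squarePrev c₁₁ ()

squareNext-adjacent : ∀ {m last ℓ p} → 2 ≤ last → Corner p → GridAdj m (suc last) ℓ p (squareNext p)
squareNext-adjacent 2≤last c₀₁ = inj₁ (right 2≤last)
squareNext-adjacent _      c₀₂ = inj₁ down
squareNext-adjacent 2≤last c₁₂ = inj₂ (right 2≤last)
squareNext-adjacent _      c₁₁ = inj₂ down

square-step : ∀ {p} → Corner p → Step Square squareNext p (squareNext p)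
square-step c = inj₁ (corner⇒square c , refl)

square-walk : ∀ {p} → Corner p → Star (Step Square squareNext) (0 , 1) p
square-walk c₀₁ = ε
square-walk c₀₂ = square-step c₀₁ ◅ ε
square-walk c₁₂ = square-step c₀₁ ◅ square-step c₀₂ ◅ ε
square-walk c₁₁ = square-step c₀₁ ◅ square-step c₀₂ ◅ square-step c₁₂ ◅ ε

squareCycle : ∀ {m last ℓ} → 2 ≤ last → HamiltonianCycle (GridAdj m (suc last) ℓ) Square
squareCycle 2≤last = record
  { next          = squareNext
  ; prev          = squarePrev
  ; next-closed   = corner⇒square ∘ corner-next ∘ corner
  ; prev-closed   = corner⇒square ∘ corner-prev ∘ corner
  ; prev-next     = squarePrev∘squareNext ∘ corner
  ; next-prev     = squareNext∘squarePrev ∘ corner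
  ; next-adjacent = squareNext-adjacent 2≤last ∘ corner
  ; next≢prev     = squareNext≢squarePrev ∘ corner
  ; start         = 0 , 1
  ; connected     = square-walk ∘ corner
  }

SquareSeparable : (m n ℓ : ℕ) {{_ : NonZero m}} {{_ : NonZero n}} → Set₁
SquareSeparable m n ℓ =
  ∀ {a b : Fin m × Fin n} → Square (coords a) → ¬ Square (coords b) → SeparatingTwoFactor (Adj m n ℓ) a b

Outside : ℕ → ℕ → Coord → Set
Outside m n p = InGrid m n p × ¬ Square p

square? : ∀ p → Dec (Square p)
square? (i , j) = i ≤? 1 ×-dec 1 ≤? j ×-dec j ≤? 2

squareSeparable : ∀ {m last ℓ} {{_ : NonZero m}} → 1 < m → 2 ≤ last →
  HamiltonianCycle (GridAdj m (suc last) ℓ) (Outside m (suc last)) → SquareSeparable m (suc last) ℓ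
squareSeparable {m} {last} 1<m 2≤last outsideCycle a∈ b∉ =
  separatingTwoFactor-of-gridPartition cover (λ sq (_ , ¬sq) → ¬sq sq)
    (λ (i≤1 , _ , j≤2) → ≤-<-trans i≤1 1<m , s≤s (≤-trans j≤2 2≤last)) proj₁
    (squareCycle 2≤last) outsideCycle a∈ (coords-inGrid _ , b∉)
  where
  cover : ∀ {p} → InGrid m (suc last) p → Square p ⊎ Outside m (suc last) p
  cover {p} p∈ with square? p
  ... | yes sq = inj₁ sq
  ... | no ¬sq = inj₂ (p∈ , ¬sq)

module _ {m last ℓ : ℕ} {{_ : NonZero m}} (1<m : 1 < m) (ℓ≤n : ℓ ≤ suc last) (2≤last : 2 ≤ last)
         (split : SquareSeparable m (suc last) ℓ) where

  private
    n : ℕ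
    n = suc last

    Separable : Fin m × Fin n → Fin m × Fin n → Set₁
    Separable = SeparatingTwoFactor (Adj m n ℓ)

    2≤-of-≢ : ∀ {q} → q ≢ 0 → q ≢ 1 → 2 ≤ q
    2≤-of-≢ {zero}        q≢0 _ = contradiction refl q≢0
    2≤-of-≢ {suc zero}    _ q≢1 = contradiction refl q≢1
    2≤-of-≢ {suc (suc q)} _ _   = s≤s (s≤s z≤n)

    [q+1]%n∉[1,2] : ∀ {q} → 2 ≤ q → q < n → ¬ (1 ≤ (q + 1) % n × (q + 1) % n ≤ 2)
    [q+1]%n∉[1,2] {q} 2≤q q<n (1≤q′ , q′≤2) with suc q <? n
    ... | yes 1+q<n = <⇒≱ (s≤s 2≤q) (subst (_≤ 2) ([k+1]%d≡1+k 1+q<n) q′≤2)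
    ... | no 1+q≮n  = contradiction (subst (1 ≤_) ([k+1]%d≡0 (<∧1+≮⇒1+≡ q<n 1+q≮n)) 1≤q′) λ ()

    -- Rotating by one column moves a into the square and keeps b off it, unless b is in column 1,
    -- where it already lies in the square while a does not.
    separable-from-origin : ∀ {a b : Fin m × Fin n} → coords a ≡ (0 , 0) → row b ≡ 0 → a ≢ b → Separable a b
    separable-from-origin {a} {b} a≡00 rb≡0 a≢b with col b ≟ 1
    ... | yes cb≡1 = separatingTwoFactor-sym (split b∈square a∉square)
      where
      b∈square : Square (coords b)
      b∈square = subst Square (sym (cong₂ _,_ rb≡0 cb≡1)) (corner⇒square c₀₁)
      a∉square : ¬ Square (coords a)
      a∉square (_ , 1≤0 , _) = contradiction (subst (1 ≤_) (cong proj₂ a≡00) 1≤0) λ ()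
    ... | no cb≢1  = transport (split a′∈square b′∉square)
      where
      open GridIso (rotation last 1 (+-comm last 1))
      a′≡01 : coords (fromCell a) ≡ (0 , 1)
      a′≡01 = trans (coords-fromCell a) (trans (cong (rotate {m} {n} {ℓ} 1) a≡00) (cong (0 ,_) (m<n⇒m%n≡m 1<n)))
        where
        1<n : 1 < n
        1<n = s≤s (≤-trans (s≤s z≤n) 2≤last)
      a′∈square : Square (coords (fromCell a))
      a′∈square = subst Square (sym a′≡01) (corner⇒square c₀₁)
      2≤cb : 2 ≤ col b
      2≤cb = 2≤-of-≢ (λ cb≡0 → a≢b (coords-injective (trans a≡00 (sym (cong₂ _,_ rb≡0 cb≡0))))) cb≢1
      b′∉square : ¬ Square (coords (fromCell b))
      b′∉square = subst (¬_ ∘ Square) (sym (coords-fromCell b))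
                    λ (_ , b′∈) → [q+1]%n∉[1,2] 2≤cb (toℕ<n (proj₂ b)) b′∈

    separable-in-row₀ : ∀ {a b : Fin m × Fin n} → row a ≡ 0 → row b ≡ 0 → a ≢ b → Separable a b
    separable-in-row₀ {a} {b} ra≡0 rb≡0 a≢b =
      transport (separable-from-origin a′≡00 (trans (cong proj₁ (coords-fromCell b)) rb≡0) (a≢b ∘ fromCell-injective))
      where
      ca≤n : col a ≤ n
      ca≤n = <⇒≤ (toℕ<n (proj₂ a))
      open GridIso (rotation (col a) (n ∸ col a) (m+[n∸m]≡n ca≤n))
      a′≡00 : coords (fromCell a) ≡ (0 , 0)
      a′≡00 = trans (coords-fromCell a) (cong₂ _,_ ra≡0 (trans (cong (_% n) (m+[n∸m]≡n ca≤n)) (n%n≡0 n)))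

    separable-in-row : ∀ r {a b : Fin m × Fin n} → row a ≡ r → row b ≡ r → a ≢ b → Separable a b
    separable-in-row zero = separable-in-row₀
    separable-in-row (suc r) {a} {b} ra≡1+r rb≡1+r a≢b =
      transport (separable-in-row r (row-above ra≡1+r) (row-above rb≡1+r) (a≢b ∘ fromCell-injective))
      where
      open GridIso (rowShift 1<m ℓ≤n)
      row-above : ∀ {x} → row x ≡ suc r → row (fromCell x) ≡ r
      row-above {x} rx≡1+r =
        trans (cong proj₁ (coords-fromCell x)) (cong (λ k → proj₁ (unshiftRow (k , col x))) rx≡1+r)

  squareSeparable⇒sameRow : ∀ {a b : Fin m × Fin n} → row a ≡ row b → a ≢ b → Separable a b
  squareSeparable⇒sameRow {a} ra≡rb = separable-in-row (row a) refl (sym ra≡rb)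

-- For n ≥ 4: the comb on all rows, with its detour (1,3) → (1,2) → (1,1) → (0,1) → (0,2) → (0,3)
-- through the square replaced by the chord (1,3) → (0,3).
module ChordedComb (m last ℓ : ℕ) (3≤m : 3 ≤ m) (3≤last : 3 ≤ last) where

  private
    2≤last : 2 ≤ last
    2≤last = ≤-trans (n≤1+n 2) 3≤last
    instance
      nonZero-m : NonZero m
      nonZero-m = >-nonZero (≤-trans (s≤s z≤n) 3≤m)
    2≤pred-m : 2 ≤ pred m
    2≤pred-m = pred-mono-≤ 3≤m
    1≤pred-m : 1 ≤ pred m
    1≤pred-m = ≤-trans (s≤s z≤n) 2≤pred-m

  open Comb last 0 (pred m)
  open Properties 2≤last

  Graph : Coord → Coord → Set
  Graph = GridAdj m (suc last) ℓ

  Region : Coord → Set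
  Region = Outside m (suc last)

  next′ : Coord → Coord
  next′ (1 , 3) = 0 , 3
  next′ p       = next p

  prev′ : Coord → Coord
  prev′ (0 , 3) = 1 , 3
  prev′ p       = prev p

  next′-other : ∀ {p} → p ≢ (1 , 3) → next′ p ≡ next p
  next′-other {0 , _} _ = refl
  next′-other {1 , 0} _ = refl
  next′-other {1 , 1} _ = refl
  next′-other {1 , 2} _ = refl
  next′-other {1 , 3} p≢ = contradiction refl p≢
  next′-other {1 , suc (suc (suc (suc _)))} _ = refl
  next′-other {suc (suc _) , _} _ = refl

  prev′-other : ∀ {p} → p ≢ (0 , 3) → prev′ p ≡ prev p
  prev′-other {0 , 0} _ = refl
  prev′-other {0 , 1} _ = refl
  prev′-other {0 , 2} _ = refl
  prev′-other {0 , 3} p≢ = contradiction refl p≢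
  prev′-other {0 , suc (suc (suc (suc _)))} _ = refl
  prev′-other {suc _ , _} _ = refl

  rows-of-grid : ∀ {p} → InGrid m (suc last) p → Rows p
  rows-of-grid (i<m , j<n) = z≤n , <⇒≤pred i<m , ≤-pred j<n

  grid-of-rows : ∀ {p} → Rows p → InGrid m (suc last) p
  grid-of-rows (_ , i≤ , j≤) = ≤-<-trans i≤ pred[n]<n , s≤s j≤

  ∉square₀₃ : ¬ Square (0 , 3)
  ∉square₀₃ (_ , _ , s≤s (s≤s ()))

  ∉square₁₃ : ¬ Square (1 , 3)
  ∉square₁₃ (_ , _ , s≤s (s≤s ()))

  outside₀₃ : Region (0 , 3)
  outside₀₃ = grid-of-rows (z≤n , z≤n , 3≤last) , ∉square₀₃

  outside₁₃ : Region (1 , 3)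
  outside₁₃ = grid-of-rows (z≤n , 1≤pred-m , 3≤last) , ∉square₁₃

  enters-square : ∀ {p} → Rows p → Square (next p) → Square p ⊎ p ≡ (1 , 3)
  enters-square {p} p∈ sq with next p | prev-next p∈ | corner sq
  ... | _ | refl | c₀₁ = inj₁ (subst Square (sym (prev-below₀ refl 1≤pred-m)) (corner⇒square c₁₁))
  ... | _ | refl | c₀₂ = inj₁ (subst Square (sym (prev-left refl)) (corner⇒square c₀₁))
  ... | _ | refl | c₁₂ = inj₂ (prev-right refl 3≤last)
  ... | _ | refl | c₁₁ = inj₁ (subst Square (sym (prev-right refl 2≤last)) (corner⇒square c₁₂))

  leaves-square : ∀ {p} → Rows p → Square (prev p) → Square p ⊎ p ≡ (0 , 3)
  leaves-square {p} p∈ sq with prev p | next-prev p∈ | corner sq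
  ... | _ | refl | c₀₁ = inj₁ (subst Square (sym (next-right refl 2≤last)) (corner⇒square c₀₂))
  ... | _ | refl | c₀₂ = inj₂ (next-right refl 3≤last)
  ... | _ | refl | c₁₂ = inj₁ (subst Square (sym (next-left refl)) (corner⇒square c₁₁))
  ... | _ | refl | c₁₁ = inj₁ (subst Square (sym (next-up₁ {1} refl)) (corner⇒square c₀₁))

  next-outside : ∀ {p} → Region p → p ≢ (1 , 3) → Region (next p)
  next-outside {p} (p∈ , p∉) p≢ =
    grid-of-rows next∈ , λ sq → [ p∉ , p≢ ]′ (enters-square (rows-of-grid p∈) sq)
    where
    next∈ : Rows (next p)
    next∈ = proj₁ (next-step {m} {ℓ} (rows-of-grid p∈))

  prev-outside : ∀ {p} → Region p → p ≢ (0 , 3) → Region (prev p)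
  prev-outside (p∈ , p∉) p≢ =
    grid-of-rows (prev-closed (rows-of-grid p∈)) , λ sq → [ p∉ , p≢ ]′ (leaves-square (rows-of-grid p∈) sq)

  _≟ᶜ_ : DecidableEquality Coord
  _≟ᶜ_ = ≡-dec _≟_ _≟_

  next′-closed : ∀ {p} → Region p → Region (next′ p)
  next′-closed {p} p∈ with p ≟ᶜ (1 , 3)
  ... | yes refl = outside₀₃
  ... | no p≢    = subst Region (sym (next′-other p≢)) (next-outside p∈ p≢)

  prev′-closed : ∀ {p} → Region p → Region (prev′ p)
  prev′-closed {p} p∈ with p ≟ᶜ (0 , 3)
  ... | yes refl = outside₁₃
  ... | no p≢    = subst Region (sym (prev′-other p≢)) (prev-outside p∈ p≢)

  prev′-next′ : ∀ {p} → Region p → prev′ (next′ p) ≡ p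
  prev′-next′ {p} (p∈ , p∉) with p ≟ᶜ (1 , 3)
  ... | yes refl = refl
  ... | no p≢ = begin
    prev′ (next′ p) ≡⟨ cong prev′ (next′-other p≢) ⟩
    prev′ (next p)  ≡⟨ prev′-other next≢₀₃ ⟩
    prev (next p)   ≡⟨ prev-next (rows-of-grid p∈) ⟩
    p               ∎
    where
    open ≡-Reasoning
    next≢₀₃ : next p ≢ (0 , 3)
    next≢₀₃ eq = p∉ (subst Square (trans (sym (cong prev eq)) (prev-next (rows-of-grid p∈)))
                                  (subst Square (sym (prev-left refl)) (corner⇒square c₀₂)))

  next′-prev′ : ∀ {p} → Region p → next′ (prev′ p) ≡ p
  next′-prev′ {p} (p∈ , p∉) with p ≟ᶜ (0 , 3)
  ... | yes refl = refl
  ... | no p≢ = begin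
    next′ (prev′ p) ≡⟨ cong next′ (prev′-other p≢) ⟩
    next′ (prev p)  ≡⟨ next′-other prev≢₁₃ ⟩
    next (prev p)   ≡⟨ next-prev (rows-of-grid p∈) ⟩
    p               ∎
    where
    open ≡-Reasoning
    prev≢₁₃ : prev p ≢ (1 , 3)
    prev≢₁₃ eq = p∉ (subst Square (trans (sym (cong next eq)) (next-prev (rows-of-grid p∈)))
                                  (subst Square (sym (next-left refl)) (corner⇒square c₁₂)))

  next′-adjacent : ∀ {p} → Region p → Graph p (next′ p)
  next′-adjacent {p} (p∈ , _) with p ≟ᶜ (1 , 3)
  ... | yes refl = inj₂ down
  ... | no p≢    = subst (Graph p) (sym (next′-other p≢)) (proj₂ (next-step (rows-of-grid p∈)))

  next′≢prev′ : ∀ {p} → Region p → next′ p ≢ prev′ p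
  next′≢prev′ {p} (p∈ , _) with p ≟ᶜ (1 , 3) | p ≟ᶜ (0 , 3)
  ... | yes refl | _ with 3 <? last | 1 <? pred m
  ...   | yes _ | _     = λ ()
  ...   | no _  | yes _ = λ ()
  ...   | no _  | no _  = λ ()
  next′≢prev′ (p∈ , _) | no _ | yes refl with 3 <? last
  ... | yes _ = λ ()
  ... | no _  = λ ()
  next′≢prev′ (p∈ , _) | no p≢₁₃ | no p≢₀₃ =
    subst₂ _≢_ (sym (next′-other p≢₁₃)) (sym (prev′-other p≢₀₃)) (next≢prev (rows-of-grid p∈))

  Walk : Coord → Coord → Set
  Walk = Star (Step Region next′)

  private
    spine-agrees : ∀ {i} → 0 ≤ i → i < pred m → Region (i , 0) × next′ (i , 0) ≡ next (i , 0)
    spine-agrees {i} _ i<hi =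
      (grid-of-rows (z≤n , <⇒≤ i<hi , z≤n) , λ { (_ , () , _) }) ,
      next′-other {i , 0} λ e → contradiction (,-injectiveʳ e) λ ()

    rows-agree : ∀ {i j} → 2 ≤ i → i ≤ pred m → j ≤ last → Region (i , j) × next′ (i , j) ≡ next (i , j)
    rows-agree {suc (suc i)} (s≤s (s≤s _)) i≤hi j≤last =
      (grid-of-rows (z≤n , i≤hi , j≤last) , λ (2+i≤1 , _) → contradiction 2+i≤1 λ { (s≤s ()) }) , refl

  open Walks 2 z≤n spine-agrees rows-agree using (spine; reach)

  row₁ : ∀ {j} → 3 ≤ j → j ≤ last → Walk (0 , 0) (1 , j)
  row₁ {j} 3≤j j≤last =
    reach ≤-refl 2≤pred-m ≤-refl ◅◅ inj₁ (proj₁ (rows-agree ≤-refl 2≤pred-m ≤-refl) , sym up) ◅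
    Star.reverse Step-sym (Star-chain (λ k → 1 , k) j≤last step)
    where
    up : next (2 , last) ≡ (1 , last)
    up = trans (cong (λ x → next (2 , x)) (sym last≡suc)) (next-up₀ refl last≡suc (s≤s z≤n))
    step : ∀ {k} → j ≤ k → k < last → Step Region next′ (1 , k) (1 , suc k)
    step j≤k = step′ (≤-trans 3≤j j≤k)
      where
      step′ : ∀ {k} → 3 ≤ k → k < last → Step Region next′ (1 , k) (1 , suc k)
      step′ (s≤s (s≤s (s≤s _))) k<last =
        inj₂ ((grid-of-rows (z≤n , 1≤pred-m , k<last) , λ { (_ , _ , s≤s (s≤s ())) }) , sym (next-left refl))

  row₀ : ∀ {j} → 3 ≤ j → j ≤ last → Walk (0 , 0) (0 , j)
  row₀ {j} 3≤j j≤last =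
    row₁ ≤-refl 3≤last ◅◅ inj₁ (outside₁₃ , refl) ◅ Star-chain (λ k → 0 , k) 3≤j step
    where
    step : ∀ {k} → 3 ≤ k → k < j → Step Region next′ (0 , k) (0 , suc k)
    step (s≤s (s≤s (s≤s _))) k<j =
      inj₁ ((grid-of-rows (z≤n , z≤n , <⇒≤ k<last) , λ { (_ , _ , s≤s (s≤s ())) }) , sym (next-right refl k<last))
      where
      k<last : _ < last
      k<last = <-≤-trans k<j j≤last

  connected : ∀ {p} → Region p → Walk (0 , 0) p
  connected (p∈ , p∉) = connected′ (rows-of-grid p∈) p∉
    where
    connected′ : ∀ {p} → Rows p → ¬ Square p → Walk (0 , 0) p
    connected′ {suc (suc _) , _} (_ , i≤ , j≤) _ = reach (s≤s (s≤s z≤n)) i≤ j≤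
    connected′ {_ , 0} (_ , i≤ , _) _            = spine z≤n i≤
    connected′ {0 , suc (suc (suc _))} (_ , _ , j≤) _ = row₀ (s≤s (s≤s (s≤s z≤n))) j≤
    connected′ {1 , suc (suc (suc _))} (_ , _ , j≤) _ = row₁ (s≤s (s≤s (s≤s z≤n))) j≤
    connected′ {0 , 1} _ p∉ = contradiction (corner⇒square c₀₁) p∉
    connected′ {0 , 2} _ p∉ = contradiction (corner⇒square c₀₂) p∉
    connected′ {1 , 1} _ p∉ = contradiction (corner⇒square c₁₁) p∉
    connected′ {1 , 2} _ p∉ = contradiction (corner⇒square c₁₂) p∉

  chordedComb : HamiltonianCycle Graph Region
  chordedComb = record
    { next          = next′
    ; prev          = prev′
    ; next-closed   = next′-closed
    ; prev-closed   = prev′-closed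
    ; prev-next     = prev′-next′
    ; next-prev     = next′-prev′
    ; next-adjacent = next′-adjacent
    ; next≢prev     = next′≢prev′
    ; start         = 0 , 0
    ; connected     = connected
    }

-- For n = 3 and ℓ = 1: up column 0 from (m − 1 , 0) to (0 , 0), along the jump edge to (m − 1 , 2),
-- up column 2 to (2 , 2), across to (2 , 1), down column 1 to (m − 1 , 1) and across to (m − 1 , 0).
module ColumnCycle (m : ℕ) (3≤m : 3 ≤ m) where

  data Cell : Coord → Set where
    col₀ : ∀ {i} → i < m → Cell (i , 0)
    col₁ : ∀ {i} → 2 ≤ i → i < m → Cell (i , 1)
    col₂ : ∀ {i} → 2 ≤ i → i < m → Cell (i , 2)

  view : ∀ {p} → Outside m 3 p → Cell p
  view {i , 0} ((i<m , _) , _) = col₀ i<m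
  view {0 , 1} (_ , ¬sq) = contradiction (corner⇒square c₀₁) ¬sq
  view {1 , 1} (_ , ¬sq) = contradiction (corner⇒square c₁₁) ¬sq
  view {suc (suc i) , 1} ((i<m , _) , _) = col₁ (s≤s (s≤s z≤n)) i<m
  view {0 , 2} (_ , ¬sq) = contradiction (corner⇒square c₀₂) ¬sq
  view {1 , 2} (_ , ¬sq) = contradiction (corner⇒square c₁₂) ¬sq
  view {suc (suc i) , 2} ((i<m , _) , _) = col₂ (s≤s (s≤s z≤n)) i<m
  view {_ , suc (suc (suc _))} ((_ , s≤s (s≤s (s≤s ()))) , _)

  unview : ∀ {p} → Cell p → Outside m 3 p
  unview (col₀ i<m)     = (i<m , s≤s z≤n) , λ ()
  unview (col₁ 2≤i i<m) = (i<m , s≤s (s≤s z≤n)) , λ (i≤1 , _) → contradiction (≤-trans 2≤i i≤1) λ { (s≤s ()) }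
  unview (col₂ 2≤i i<m) = (i<m , ≤-refl) , λ (i≤1 , _) → contradiction (≤-trans 2≤i i≤1) λ { (s≤s ()) }

  next : Coord → Coord
  next (i , 1) with suc i <? m
  ... | yes _ = suc i , 1
  ... | no _  = i , 0
  next (zero , 0)  = pred m , 2
  next (suc i , 0) = i , 0
  next (suc (suc (suc i)) , 2) = suc (suc i) , 2
  next (i , 2) = i , 1
  next p = p

  prev : Coord → Coord
  prev (i , 0) with suc i <? m
  ... | yes _ = suc i , 0
  ... | no _  = i , 1
  prev (i , 2) with suc i <? m
  ... | yes _ = suc i , 2
  ... | no _  = 0 , 0
  prev (suc (suc (suc i)) , 1) = suc (suc i) , 1
  prev (i , 1) = i , 2
  prev p = p

  private
    instance
      nonZero-m : NonZero m
      nonZero-m = >-nonZero (≤-trans (s≤s z≤n) 3≤m)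

    1+pred-m : suc (pred m) ≡ m
    1+pred-m = suc-pred m

    2≤pred-m : 2 ≤ pred m
    2≤pred-m = pred-mono-≤ 3≤m

    2≤-of-last : ∀ {i} → suc i ≡ m → 2 ≤ i
    2≤-of-last 1+i≡m = ≤-pred (subst (3 ≤_) (sym 1+i≡m) 3≤m)

    2≤1+i : ∀ {i} → 2 ≤ i → 2 ≤ suc i
    2≤1+i 2≤i = ≤-trans 2≤i (n≤1+n _)

  next-col₁-inner : ∀ {i} → suc i < m → next (i , 1) ≡ (suc i , 1)
  next-col₁-inner {i} 1+i<m with suc i <? m
  ... | yes _    = refl
  ... | no 1+i≮m = contradiction 1+i<m 1+i≮m

  next-col₁-last : ∀ {i} → ¬ suc i < m → next (i , 1) ≡ (i , 0)
  next-col₁-last {i} 1+i≮m with suc i <? m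
  ... | yes 1+i<m = contradiction 1+i<m 1+i≮m
  ... | no _      = refl

  prev-col₀-inner : ∀ {i} → suc i < m → prev (i , 0) ≡ (suc i , 0)
  prev-col₀-inner {i} 1+i<m with suc i <? m
  ... | yes _    = refl
  ... | no 1+i≮m = contradiction 1+i<m 1+i≮m

  prev-col₀-last : ∀ {i} → ¬ suc i < m → prev (i , 0) ≡ (i , 1)
  prev-col₀-last {i} 1+i≮m with suc i <? m
  ... | yes 1+i<m = contradiction 1+i<m 1+i≮m
  ... | no _      = refl

  prev-col₂-inner : ∀ {i} → suc i < m → prev (i , 2) ≡ (suc i , 2)
  prev-col₂-inner {i} 1+i<m with suc i <? m
  ... | yes _    = refl
  ... | no 1+i≮m = contradiction 1+i<m 1+i≮m

  prev-col₂-last : prev (pred m , 2) ≡ (0 , 0)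
  prev-col₂-last with suc (pred m) <? m
  ... | yes m<m = contradiction m<m (<-irrefl 1+pred-m)
  ... | no _    = refl

  next-closed : ∀ {p} → Cell p → Cell (next p)
  next-closed (col₀ {zero} _)      = col₂ 2≤pred-m pred[n]<n
  next-closed (col₀ {suc i} 1+i<m) = col₀ (<-trans (n<1+n i) 1+i<m)
  next-closed (col₁ {i} 2≤i i<m) with suc i <? m
  ... | yes 1+i<m = col₁ (2≤1+i 2≤i) 1+i<m
  ... | no _      = col₀ i<m
  next-closed (col₂ {suc (suc (suc i))} (s≤s (s≤s _)) i<m) = col₂ (s≤s (s≤s z≤n)) (<-trans (n<1+n _) i<m)
  next-closed (col₂ {suc (suc zero)} 2≤i@(s≤s (s≤s z≤n)) i<m)  = col₁ 2≤i i<m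

  prev-closed : ∀ {p} → Cell p → Cell (prev p)
  prev-closed (col₀ {i} i<m) with suc i <? m
  ... | yes 1+i<m = col₀ 1+i<m
  ... | no 1+i≮m  = col₁ (2≤-of-last (<∧1+≮⇒1+≡ i<m 1+i≮m)) i<m
  prev-closed (col₁ {suc (suc (suc i))} (s≤s (s≤s _)) i<m) = col₁ (s≤s (s≤s z≤n)) (<-trans (n<1+n _) i<m)
  prev-closed (col₁ {suc (suc zero)} 2≤i@(s≤s (s≤s z≤n)) i<m)  = col₂ 2≤i i<m
  prev-closed (col₂ {i} 2≤i i<m) with suc i <? m
  ... | yes 1+i<m = col₂ (2≤1+i 2≤i) 1+i<m
  ... | no _      = col₀ (≤-trans (s≤s z≤n) 3≤m)

  prev-next : ∀ {p} → Cell p → prev (next p) ≡ p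
  prev-next (col₀ {zero} _)      = prev-col₂-last
  prev-next (col₀ {suc i} 1+i<m) = prev-col₀-inner 1+i<m
  prev-next (col₁ {i} (s≤s (s≤s _)) i<m) with suc i <? m
  ... | yes _    = refl
  ... | no 1+i≮m = prev-col₀-last 1+i≮m
  prev-next (col₂ {suc (suc (suc i))} (s≤s (s≤s _)) i<m) = prev-col₂-inner i<m
  prev-next (col₂ {suc (suc zero)} (s≤s (s≤s z≤n)) _)      = refl

  next-prev : ∀ {p} → Cell p → next (prev p) ≡ p
  next-prev (col₀ {i} i<m) with suc i <? m
  ... | yes _    = refl
  ... | no 1+i≮m = next-col₁-last 1+i≮m
  next-prev (col₁ {suc (suc (suc i))} (s≤s (s≤s _)) i<m) = next-col₁-inner i<m
  next-prev (col₁ {suc (suc zero)} (s≤s (s≤s z≤n)) _)      = refl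
  next-prev (col₂ {i} (s≤s (s≤s _)) i<m) with suc i <? m
  ... | yes _    = refl
  ... | no 1+i≮m = cong (_, 2) (cong pred (sym (<∧1+≮⇒1+≡ i<m 1+i≮m)))

  next-adjacent : ∀ {p} → Cell p → GridAdj m 3 1 p (next p)
  next-adjacent (col₀ {zero} _)  = inj₂ (jump 1+pred-m refl refl)
  next-adjacent (col₀ {suc i} _) = inj₂ down
  next-adjacent (col₁ {i} _ _) with suc i <? m
  ... | yes _ = inj₁ down
  ... | no _  = inj₂ (right (s≤s z≤n))
  next-adjacent (col₂ {suc (suc (suc i))} (s≤s (s≤s _)) _) = inj₂ down
  next-adjacent (col₂ {suc (suc zero)} (s≤s (s≤s z≤n)) _)    = inj₂ (right (s≤s (s≤s z≤n)))

  next≢prev : ∀ {p} → Cell p → next p ≢ prev p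
  next≢prev (col₀ {zero} _) with 1 <? m
  ... | yes _ = λ ()
  ... | no _  = λ ()
  next≢prev (col₀ {suc i} _) with suc (suc i) <? m
  ... | yes _ = λ e → 2+n≢n (sym (,-injectiveˡ e))
  ... | no _  = λ ()
  next≢prev (col₁ {suc (suc zero)} (s≤s (s≤s z≤n)) _) with 3 <? m
  ... | yes _ = λ ()
  ... | no _  = λ ()
  next≢prev (col₁ {suc (suc (suc i))} (s≤s (s≤s _)) _) with suc (suc (suc (suc i))) <? m
  ... | yes _ = λ e → 2+n≢n (,-injectiveˡ e)
  ... | no _  = λ ()
  next≢prev (col₂ {suc (suc zero)} (s≤s (s≤s z≤n)) _) with 3 <? m
  ... | yes _ = λ ()
  ... | no _  = λ ()
  next≢prev (col₂ {suc (suc (suc i))} (s≤s (s≤s _)) _) with suc (suc (suc (suc i))) <? m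
  ... | yes _ = λ e → 2+n≢n (sym (,-injectiveˡ e))
  ... | no _  = λ ()

  Walk : Coord → Coord → Set
  Walk = Star (Step (Outside m 3) next)

  column₀ : ∀ {i} → i < m → Walk (0 , 0) (i , 0)
  column₀ i<m = Star-chain (λ k → k , 0) z≤n
    λ _ k<i → inj₂ (unview (col₀ (≤-<-trans k<i i<m)) , refl)

  column₂ : ∀ {i} → 2 ≤ i → i < m → Walk (0 , 0) (i , 2)
  column₂ {i} 2≤i i<m =
    inj₁ (unview (col₀ (≤-trans (s≤s z≤n) 3≤m)) , refl)
    ◅ Star.reverse Step-sym (Star-chain (λ k → k , 2) (<⇒≤pred i<m) step)
    where
    step : ∀ {k} → i ≤ k → k < pred m → Step (Outside m 3) next (k , 2) (suc k , 2)
    step {suc (suc k)} _ k<pred-m =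
      inj₂ (unview (col₂ (s≤s (s≤s z≤n)) (<-≤-trans (s≤s k<pred-m) (≤-reflexive 1+pred-m))) , refl)
    step {0} 2≤k = contradiction (≤-trans 2≤i 2≤k) λ ()
    step {1} 2≤k = contradiction (≤-trans 2≤i 2≤k) λ { (s≤s ()) }

  column₁ : ∀ {i} → 2 ≤ i → i < m → Walk (0 , 0) (i , 1)
  column₁ {i} 2≤i i<m =
    column₂ ≤-refl 3≤m ◅◅ inj₁ (unview (col₂ ≤-refl 3≤m) , refl)
    ◅ Star-chain (λ k → k , 1) 2≤i
      (λ 2≤k k<i → inj₁ (unview (col₁ 2≤k (<-trans k<i i<m)) , sym (next-col₁-inner (≤-<-trans k<i i<m))))

  connected : ∀ {p} → Cell p → Walk (0 , 0) p
  connected (col₀ i<m)     = column₀ i<m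
  connected (col₁ 2≤i i<m) = column₁ 2≤i i<m
  connected (col₂ 2≤i i<m) = column₂ 2≤i i<m

  columnCycle : HamiltonianCycle (GridAdj m 3 1) (Outside m 3)
  columnCycle = record
    { next          = next
    ; prev          = prev
    ; next-closed   = unview ∘ next-closed ∘ view
    ; prev-closed   = unview ∘ prev-closed ∘ view
    ; prev-next     = prev-next ∘ view
    ; next-prev     = next-prev ∘ view
    ; next-adjacent = next-adjacent ∘ view
    ; next≢prev     = next≢prev ∘ view
    ; start         = 0 , 0
    ; connected     = connected ∘ view
    }

separatingTwoFactor-of-sameRow-untwisted : ∀ {m′ last} → 2 ≤ m′ → 2 ≤ last →
  ∀ {a b : Fin (suc m′) × Fin (suc last)} → row a ≡ row b → a ≢ b →
  SeparatingTwoFactor (Adj (suc m′) (suc last) 0) a b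
separatingTwoFactor-of-sameRow-untwisted {m′} {last} 2≤m′ 2≤last {a} {b} ra≡rb a≢b =
  transport (separatingTwoFactor-of-row≢ 2≤m′ λ ca≡cb → a≢b (coords-injective (cong₂ _,_ ra≡rb (rows-equal ca≡cb))))
  where
  open GridIso (transposition {suc last} {suc m′})
  rows-equal : row (fromCell a) ≡ row (fromCell b) → col a ≡ col b
  rows-equal eq = trans (sym (cong proj₁ (coords-fromCell a))) (trans eq (cong proj₁ (coords-fromCell b)))

separatingTwoFactor-of-outsideCycle : ∀ {m′ last ℓ} → 2 ≤ m′ → 2 ≤ last → ℓ ≤ suc last →
  HamiltonianCycle (GridAdj (suc m′) (suc last) ℓ) (Outside (suc m′) (suc last)) →
  ∀ {a b : Fin (suc m′) × Fin (suc last)} → row a ≡ row b → a ≢ b → SeparatingTwoFactor (Adj (suc m′) (suc last) ℓ) a b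
separatingTwoFactor-of-outsideCycle {m′} 2≤m′ 2≤last ℓ≤n outsideCycle =
  squareSeparable⇒sameRow 1<m ℓ≤n 2≤last (squareSeparable 1<m 2≤last outsideCycle)
  where
  1<m : 1 < suc m′
  1<m = s≤s (≤-trans (s≤s z≤n) 2≤m′)

separatingTwoFactor-of-sameRow : ∀ {m′ last ℓ} → 2 ≤ m′ → 2 ≤ last → ℓ ≤ last →
  ∀ {a b : Fin (suc m′) × Fin (suc last)} → row a ≡ row b → a ≢ b →
  SeparatingTwoFactor (Adj (suc m′) (suc last) ℓ) a b
separatingTwoFactor-of-sameRow {ℓ = zero} 2≤m′ 2≤last _ = separatingTwoFactor-of-sameRow-untwisted 2≤m′ 2≤last
separatingTwoFactor-of-sameRow {m′} {last@(suc (suc (suc _)))} {ℓ@(suc _)} 2≤m′ 2≤last ℓ≤last =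
  separatingTwoFactor-of-outsideCycle 2≤m′ 2≤last (≤-trans ℓ≤last (n≤1+n _))
    (ChordedComb.chordedComb (suc m′) last ℓ (s≤s 2≤m′) (s≤s (s≤s (s≤s z≤n))))
separatingTwoFactor-of-sameRow {m′} {2} {1} 2≤m′ 2≤last _ =
  separatingTwoFactor-of-outsideCycle 2≤m′ 2≤last (s≤s z≤n) (ColumnCycle.columnCycle (suc m′) (s≤s 2≤m′))
separatingTwoFactor-of-sameRow {m′} {2} {2} 2≤m′ 2≤last _ {a} {b} ra≡rb a≢b =
  separatingTwoFactor-mirror
    (separatingTwoFactor-of-sameRow {ℓ = 1} 2≤m′ 2≤last (s≤s z≤n)
      (trans (row-mirror a) (trans ra≡rb (sym (row-mirror b))))
      (a≢b ∘ mirror-injective))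
separatingTwoFactor-of-sameRow {last = 2} {suc (suc (suc _))} _ _ (s≤s (s≤s ()))
separatingTwoFactor-of-sameRow {last = 1} {suc _} _ (s≤s ()) _

separatingTwoFactor : ∀ {m′ last ℓ} → 2 ≤ m′ → 2 ≤ last → ℓ ≤ last →
  ∀ {a b : Fin (suc m′) × Fin (suc last)} → a ≢ b → SeparatingTwoFactor (Adj (suc m′) (suc last) ℓ) a b
separatingTwoFactor 2≤m′ 2≤last ℓ≤last {a} {b} a≢b with row a ≟ row b
... | yes ra≡rb = separatingTwoFactor-of-sameRow 2≤m′ 2≤last ℓ≤last ra≡rb a≢b
... | no ra≢rb  = separatingTwoFactor-of-row≢ 2≤last ra≢rb

corollary3p4p1 : ∀ (m n ℓ : ℕ) → 3 ≤ m → 3 ≤ n → ℓ < n →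
    SpanningCyclable (Adj m n ℓ) 2
corollary3p4p1 (suc m′) (suc last) ℓ (s≤s 2≤m′) (s≤s 2≤last) (s≤s ℓ≤last) (a ∷ b ∷ []) ((a≢b ∷ []) ∷ _) refl =
  separatingTwoFactor 2≤m′ 2≤last ℓ≤last a≢b
corollary3p4p1 _ _ _ _ _ _ []               _ ()
corollary3p4p1 _ _ _ _ _ _ (_ ∷ [])         _ ()
corollary3p4p1 _ _ _ _ _ _ (_ ∷ _ ∷ _ ∷ _)  _ ()
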